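{- Let $r\ge 1$ and $k$ be integers, and write $k=(2r+1)p+q$ with $p\ge 1$ an integer and $q\in\{0,1,\dots,2r\}$. Let $C_{2k+1}$ be the cycle on $2k+1$ vertices. Then: (a) if $\gcd(2r+1,2k+1)\neq 1$, then $M_r^I(C_{2k+1})=\gcd(2r+1,2k+1)\left\lceil \frac{2k+1}{2\gcd(2r+1,2k+1)}\right\rceil$; (b) if $\gcd(2r+1,2k+1)=1$ and $q\in\{0,2r\}$, then $M_r^I(C_{2k+1})=k+2$; (c) in all other cases, $M_r^I(C_{2k+1})=k+1$.
   Context: For a graph $G=(V,E)$ and integer $r\ge1$, $d(x,y)$ is the number of edges in a shortest path between $x$ and $y$, $N_r[x]=\{y\in V: d(x,y)\le r\}$, and for $D\subseteq V$, $D_r(x)=N_r[x]\cap D$. A set $D\subseteq V$ is an $r$-identifying code ($r$-IC) of $G$ if $D_r(x)\neq\emptyset$ for every $x\in V$ and $D_r(x)\neq D_r(y)$ for all distinct $x,y\in V$. $M_r^I(G)$ denotes the minimum cardinality of an $r$-identifying code of $G$. -}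

module Defs where

open import Data.Nat using (ℕ; zero; suc; _+_; _*_; _≤_; NonZero)
open import Data.Nat.DivMod using (_/_; _%_)
open import Data.Fin using (Fin; toℕ)
open import Data.Fin.Subset using (Subset; _∈_; ∣_∣)
open import Data.Product using (Σ; ∃; _×_)
open import Data.Sum using (_⊎_)
open import Relation.Binary.PropositionalEquality using (_≡_)
open import Relation.Nullary using (¬_)
open import Function.Bundles using (_⇔_)

Graph : ℕ → Set₁
Graph n = Fin n → Fin n → Set

data Walk {n : ℕ} (G : Graph n) : ℕ → Fin n → Fin n → Set where
  here : ∀ {x} → Walk G zero x x
  step : ∀ {ℓ x y z} → G x y → Walk G ℓ y z → Walk G (suc ℓ) x z

WithinDist : {n : ℕ} → Graph n → ℕ → Fin n → Fin n → Set
WithinDist G r x y = Σ ℕ λ ℓ → ℓ ≤ r × Walk G ℓ x y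

DrNonempty : {n : ℕ} → Graph n → ℕ → Subset n → Fin n → Set
DrNonempty G r D x = ∃ λ z → z ∈ D × WithinDist G r x z

DrEqual : {n : ℕ} → Graph n → ℕ → Subset n → Fin n → Fin n → Set
DrEqual G r D x y = ∀ z → z ∈ D → (WithinDist G r x z ⇔ WithinDist G r y z)

IsIdCode : {n : ℕ} → Graph n → ℕ → Subset n → Set
IsIdCode G r D =
  (∀ x → DrNonempty G r D x) ×
  (∀ x y → ¬ (x ≡ y) → ¬ DrEqual G r D x y)

MinIdCode : {n : ℕ} → Graph n → ℕ → ℕ → Set
MinIdCode {n} G r m =
  (Σ (Subset n) λ D → IsIdCode G r D × ∣ D ∣ ≡ m) ×
  (∀ (D : Subset n) → IsIdCode G r D → m ≤ ∣ D ∣)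

Cycle : (n : ℕ) → .{{NonZero n}} → Graph n
Cycle n x y = (toℕ y ≡ suc (toℕ x) % n) ⊎ (toℕ x ≡ suc (toℕ y) % n)

-- ceiling division ⌈a / b⌉ (for b ≥ 1; value 0 when b = 0, never used)
ceilDiv : ℕ → ℕ → ℕ
ceilDiv a zero = zero
ceilDiv a (suc b) = (a + b) / suc b

module Submission where

-- Positions are read modulo n.  The ball N_r[y + r] is the window
-- y, …, y + 2r, so (for k ≥ s) a set D is an r-identifying code iff
--   PairCover:   y ∈ D or y + s ∈ D for all y, and
--   WindowCover: every window of s consecutive vertices meets D
-- (CycleGeometry, CycleCodes).  Lower bounds come from counting
-- (Counting): pairCount y = [y ∈ D] + [y + s ∈ D] is ≥ 1 and sums to 2|D|;
-- for g ∣ gcd(s, n) every residue class mod g is an odd orbit of y ↦ y + s,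
-- which must contain a point of pair count 2, so 2|D| ≥ g·(n/g + 1).  In
-- the coprime case a code with k + 1 elements has a single such point, and
-- the forced alternation along its orbit leaves an empty window when
-- q ∈ {0, 2r} (SharpBound).  The matching codes are: the progression code
-- {-j·2s : j ≤ k} for (c) (ProgressionCodes, WindowProperty), explicit
-- anti-periodic patterns for (b) (AntiPeriodic, ExceptionalCodes), and a
-- blow-up of a progression code on the cycle of length n/g for (a)
-- (BlowUp).

open import Defs
open import Data.Nat.GCD using (gcd; gcd[m,n]∣m; gcd[m,n]∣n; gcd[m,n]≡0⇒m≡0)
open import Data.Nat
open import Data.Nat.Properties
open import Data.Bool using (Bool; true; false; _∨_; not; if_then_else_; T)
open import Data.Vec using (Vec; []; _∷_; lookup; tabulate)
open import Data.Fin using (Fin; toℕ; fromℕ<)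
open import Data.Fin.Subset using (∣_∣; Subset; _∈_)
open import Data.Product using (Σ; _×_; _,_; proj₁; proj₂)
open import Data.Sum using (_⊎_; inj₁; inj₂)
open import Data.Empty using (⊥; ⊥-elim)
open import Relation.Binary.PropositionalEquality
open import Relation.Nullary using (¬_; Dec; yes; no; does)
open import Data.Nat.Tactic.RingSolver using (solve-∀)
open import Data.Nat.DivMod
open import Data.Fin.Properties using (toℕ-injective; toℕ-fromℕ<; toℕ<n)
open import Data.Vec.Properties using ([]=⇒lookup; lookup⇒[]=; lookup∘tabulate)
import Data.Bool.Properties as Bool
open import Relation.Binary.Definitions using (tri<; tri≈; tri>)
open import Function.Bundles using (mk⇔; Equivalence)
open import Data.Nat.Divisibility using (_∣_; divides; ∣n⇒∣m*n; m%n≡0⇒n∣m; n∣m⇒m%n≡0; ∣m+n∣m⇒∣n; ∣⇒≤; ∣m∣n⇒∣m+n; n∣n; ∣1⇒≡1; 0∣⇒≡0)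
open import Data.Bool.Properties using (∨-zeroʳ; ∨-inverseʳ)
open import Algebra.Properties.CommutativeSemigroup +-commutativeSemigroup using (xy∙z≈xz∙y)
open import Data.Unit using (tt)
open import Relation.Nullary.Decidable using (dec-true; dec-false)
open import Data.Nat.Coprimality using (Coprime; coprime-divisor; gcd≡1⇒coprime; coprime-/gcd) renaming (sym to coprime-sym)

module FiniteSums where

  ∑ : ℕ → (ℕ → ℕ) → ℕ
  ∑ zero f = 0
  ∑ (suc n) f = f 0 + ∑ n (λ x → f (suc x))

  bit : Bool → ℕ
  bit true = 1
  bit false = 0

  bit≤1 : ∀ b → bit b ≤ 1
  bit≤1 true = ≤-refl
  bit≤1 false = z≤n

  bit-∨ : ∀ a b → (a ≡ true → b ≡ true → ⊥) → bit (a ∨ b) ≡ bit a + bit b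
  bit-∨ true true disjoint = ⊥-elim (disjoint refl refl)
  bit-∨ true false _ = refl
  bit-∨ false b _ = refl

  ∑-cong : ∀ n {f g : ℕ → ℕ} → (∀ x → x < n → f x ≡ g x) → ∑ n f ≡ ∑ n g
  ∑-cong zero h = refl
  ∑-cong (suc n) h = cong₂ _+_ (h 0 (s≤s z≤n)) (∑-cong n (λ x x<n → h (suc x) (s≤s x<n)))

  ∑-+ : ∀ n (f g : ℕ → ℕ) → ∑ n (λ x → f x + g x) ≡ ∑ n f + ∑ n g
  ∑-+ zero f g = refl
  ∑-+ (suc n) f g rewrite ∑-+ n (λ x → f (suc x)) (λ x → g (suc x)) = swap4 (f 0) (g 0) _ _
    where
    swap4 : ∀ a b c d → a + b + (c + d) ≡ a + c + (b + d)
    swap4 = solve-∀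

  ∑-* : ∀ n c (f : ℕ → ℕ) → ∑ n (λ x → c * f x) ≡ c * ∑ n f
  ∑-* zero c f = sym (*-zeroʳ c)
  ∑-* (suc n) c f = trans (cong (c * f 0 +_) (∑-* n c (λ x → f (suc x)))) (sym (*-distribˡ-+ c (f 0) _))

  ∑-split : ∀ a b (f : ℕ → ℕ) → ∑ (a + b) f ≡ ∑ a f + ∑ b (λ x → f (a + x))
  ∑-split zero b f = refl
  ∑-split (suc a) b f rewrite ∑-split a b (λ x → f (suc x)) = sym (+-assoc (f 0) _ _)

  ∑-const : ∀ n c → ∑ n (λ _ → c) ≡ n * c
  ∑-const zero c = refl
  ∑-const (suc n) c = cong (c +_) (∑-const n c)

  ∑-zero : ∀ n {f : ℕ → ℕ} → (∀ x → x < n → f x ≡ 0) → ∑ n f ≡ 0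
  ∑-zero n h = trans (∑-cong n h) (trans (∑-const n 0) (*-zeroʳ n))

  ∑-single : ∀ n {f : ℕ → ℕ} x₀ → x₀ < n → (∀ x → x < n → x ≢ x₀ → f x ≡ 0) → ∑ n f ≡ f x₀
  ∑-single (suc n) {f} zero _ h =
    trans (cong (f 0 +_) (∑-zero n (λ x x<n → h (suc x) (s≤s x<n) (λ ())))) (+-identityʳ _)
  ∑-single (suc n) {f} (suc x₀) (s≤s x₀<n) h =
    trans (cong (_+ ∑ n (λ x → f (suc x))) (h 0 (s≤s z≤n) (λ ())))
          (∑-single n x₀ x₀<n (λ x x<n x≢ → h (suc x) (s≤s x<n) (λ e → x≢ (suc-injective e))))

  ∑-shift : ∀ n (f : ℕ → ℕ) → (∀ x → f (x + n) ≡ f x) → ∀ a → ∑ n (λ x → f (x + a)) ≡ ∑ n f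
  ∑-shift n f periodic zero = ∑-cong n (λ x _ → cong f (+-identityʳ x))
  ∑-shift n f periodic (suc a) = begin
    ∑ n (λ x → f (x + suc a))      ≡⟨ ∑-cong n (λ x _ → cong f (+-suc x a)) ⟩
    ∑ n (λ x → f' (suc x))         ≡⟨ rotate ⟩
    ∑ n f'                         ≡⟨ ∑-shift n f periodic a ⟩
    ∑ n f                          ∎
    where
    open ≡-Reasoning
    f' : ℕ → ℕ
    f' x = f (x + a)
    -- moving the first summand to the end: f' n = f' 0 by periodicity
    rotate : ∑ n (λ x → f' (suc x)) ≡ ∑ n f'
    rotate = +-cancelˡ-≡ (f' 0) _ _ (begin
      f' 0 + ∑ n (λ x → f' (suc x))  ≡⟨ cong (λ m → ∑ m f') (+-comm 1 n) ⟩
      ∑ (n + 1) f'                   ≡⟨ ∑-split n 1 f' ⟩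
      ∑ n f' + (f' (n + 0) + 0)      ≡⟨ cong (∑ n f' +_) (trans (+-identityʳ _) (cong f' (+-identityʳ n))) ⟩
      ∑ n f' + f' n                  ≡⟨ cong (∑ n f' +_) (trans (cong f (+-comm n a)) (periodic a)) ⟩
      ∑ n f' + f' 0                  ≡⟨ +-comm (∑ n f') (f' 0) ⟩
      f' 0 + ∑ n f'                  ∎)

  ∑-mono : ∀ n {f g : ℕ → ℕ} → (∀ x → x < n → f x ≤ g x) → ∑ n f ≤ ∑ n g
  ∑-mono zero h = z≤n
  ∑-mono (suc n) h = +-mono-≤ (h 0 (s≤s z≤n)) (∑-mono n (λ x x<n → h (suc x) (s≤s x<n)))

  ∑-positive : ∀ n {f : ℕ → ℕ} → (∀ x → x < n → 1 ≤ f x) → n ≤ ∑ n f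
  ∑-positive n h = subst (_≤ ∑ n _) (trans (∑-const n 1) (*-identityʳ n)) (∑-mono n h)

  ∑-positive+1 : ∀ n {f : ℕ → ℕ} → (∀ x → x < n → 1 ≤ f x) →
    ∀ i → i < n → 2 ≤ f i → suc n ≤ ∑ n f
  ∑-positive+1 (suc n) h zero _ f2 = +-mono-≤ f2 (∑-positive n (λ x x<n → h (suc x) (s≤s x<n)))
  ∑-positive+1 (suc n) h (suc i) (s≤s i<n) f2 =
    +-mono-≤ (h 0 (s≤s z≤n)) (∑-positive+1 n (λ x x<n → h (suc x) (s≤s x<n)) i i<n f2)

  ∑-positive+2 : ∀ n {f : ℕ → ℕ} → (∀ x → x < n → 1 ≤ f x) →
    ∀ i j → i < n → j < n → i ≢ j → 2 ≤ f i → 2 ≤ f j → 2 + n ≤ ∑ n f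
  ∑-positive+2 (suc n) h zero zero _ _ i≢j _ _ = ⊥-elim (i≢j refl)
  ∑-positive+2 (suc n) h zero (suc j) _ (s≤s j<n) _ fi fj =
    +-mono-≤ fi (∑-positive+1 n (λ x x<n → h (suc x) (s≤s x<n)) j j<n fj)
  ∑-positive+2 (suc n) h (suc i) zero (s≤s i<n) _ _ fi fj =
    +-mono-≤ fj (∑-positive+1 n (λ x x<n → h (suc x) (s≤s x<n)) i i<n fi)
  ∑-positive+2 (suc n) h (suc i) (suc j) (s≤s i<n) (s≤s j<n) i≢j fi fj =
    +-mono-≤ (h 0 (s≤s z≤n))
      (∑-positive+2 n (λ x x<n → h (suc x) (s≤s x<n)) i j i<n j<n (λ e → i≢j (cong suc e)) fi fj)

  ∑-all-one : ∀ n (f : ℕ → ℕ) → (∀ x → x < n → f x ≤ 1) → ∑ n f ≡ n → ∀ x → x < n → f x ≡ 1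
  ∑-all-one (suc n) f le total x x<n with x
  ... | zero = ≤-antisym (le 0 (s≤s z≤n))
          (+-cancelʳ-≤ n 1 (f 0) (≤-trans (≤-reflexive (sym total)) (+-monoʳ-≤ (f 0) rest≤)))
    where
    rest≤ : ∑ n (λ y → f (suc y)) ≤ n
    rest≤ = ≤-trans (∑-mono n (λ y y<n → le (suc y) (s≤s y<n))) (≤-reflexive (trans (∑-const n 1) (*-identityʳ n)))
  ... | suc x' = ∑-all-one n (λ y → f (suc y)) (λ y y<n → le (suc y) (s≤s y<n)) rest≡ x' (s≤s⁻¹ x<n)
    where
    rest≤ : ∑ n (λ y → f (suc y)) ≤ n
    rest≤ = ≤-trans (∑-mono n (λ y y<n → le (suc y) (s≤s y<n))) (≤-reflexive (trans (∑-const n 1) (*-identityʳ n)))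
    rest≡ : ∑ n (λ y → f (suc y)) ≡ n
    rest≡ = ≤-antisym rest≤ (+-cancelˡ-≤ 1 _ _ (≤-trans (≤-reflexive (sym total)) (+-monoˡ-≤ _ (le 0 (s≤s z≤n)))))

  ∑-blocks : ∀ L g (f : ℕ → ℕ) → ∑ (L * g) f ≡ ∑ L (λ b → ∑ g (λ c → f (b * g + c)))
  ∑-blocks zero g f = refl
  ∑-blocks (suc L) g f = trans (∑-split g (L * g) f)
    (cong (∑ g f +_) (trans (∑-blocks L g (λ x → f (g + x)))
       (∑-cong L (λ b _ → ∑-cong g (λ c _ → cong f (sym (+-assoc g (b * g) c)))))))

  ∑-swap : ∀ a b (F : ℕ → ℕ → ℕ) → ∑ a (λ i → ∑ b (F i)) ≡ ∑ b (λ c → ∑ a (λ i → F i c))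
  ∑-swap zero b F = sym (∑-zero b (λ _ _ → refl))
  ∑-swap (suc a) b F = trans (cong (∑ b (F 0) +_) (∑-swap a b (λ i → F (suc i))))
    (sym (∑-+ b (F 0) (λ c → ∑ a (λ i → F (suc i) c))))

-- Parity facts, phrased with doublings x + x as they arise below.
module Parity where

  double≢odd : ∀ x y → x + x ≢ suc (y + y)
  double≢odd x y e =
    even≢odd x y (trans (cong (x +_) (+-identityʳ x)) (trans e (cong (λ z → suc (y + z)) (sym (+-identityʳ y)))))

  double-injective : ∀ x y → x + x ≡ y + y → x ≡ y
  double-injective zero zero e = refl
  double-injective zero (suc y) ()
  double-injective (suc x) zero ()
  double-injective (suc x) (suc y) e rewrite +-suc x x | +-suc y y =
    cong suc (double-injective x y (suc-injective (suc-injective e)))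

  even-or-odd : ∀ L → Σ ℕ λ a → L ≡ a + a ⊎ L ≡ suc (a + a)
  even-or-odd zero = 0 , inj₁ refl
  even-or-odd (suc L) with even-or-odd L
  ... | a , inj₁ e = a , inj₂ (cong suc e)
  ... | a , inj₂ e = suc a , inj₁ (trans (cong suc e) (sym (+-suc (suc a) a)))

  -- A sequence with e j + e (j + 1) = 1 for all j alternates between two
  -- values, so it cannot return to its initial value after an odd number
  -- of steps.
  alternating-period : ∀ (e : ℕ → ℕ) → (∀ j → e j + e (suc j) ≡ 1) → ∀ j → e (suc (suc j)) ≡ e j
  alternating-period e alt j =
    +-cancelˡ-≡ (e (suc j)) _ _ (trans (alt (suc j)) (sym (trans (+-comm (e (suc j)) (e j)) (alt j))))

  alternating-odd : ∀ (e : ℕ → ℕ) → (∀ j → e j + e (suc j) ≡ 1) → ∀ a → e (suc (a + a)) ≢ e 0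
  alternating-odd e alt a e-odd = double≢odd (e 0) 0 (trans (cong (e 0 +_) (sym e-odd)) (subst (λ z → z + e (suc (a + a)) ≡ 1) (even a) (alt (a + a))))
    where
    even : ∀ i → e (i + i) ≡ e 0
    even zero = refl
    even (suc i) = trans (cong (λ z → e (suc z)) (+-suc i i)) (trans (alternating-period e alt (i + i)) (even i))

module BoundedSearch where

  search : ∀ L (P : ℕ → Set) → (∀ b → Dec (P b)) → (Σ ℕ λ b → b < L × P b) ⊎ (∀ b → b < L → ¬ P b)
  search zero P dec = inj₂ (λ b ())
  search (suc L) P dec with search L P dec | dec L
  ... | inj₁ (b , b<L , pb) | _ = inj₁ (b , m≤n⇒m≤1+n b<L , pb)
  ... | inj₂ _ | yes pL = inj₁ (L , ≤-refl , pL)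
  ... | inj₂ none | no ¬pL = inj₂ λ b b<1+L pb → below (m≤n⇒m<n∨m≡n (s≤s⁻¹ b<1+L)) pb
    where
    below : ∀ {b} → b < L ⊎ b ≡ L → P b → ⊥
    below (inj₁ lt) pb = none _ lt pb
    below (inj₂ refl) pb = ¬pL pb

module Cardinality where
  open FiniteSums

  bitAt : ∀ {m} → Vec Bool m → ℕ → ℕ
  bitAt [] x = 0
  bitAt (b ∷ D) zero = bit b
  bitAt (b ∷ D) (suc x) = bitAt D x

  card-∑ : ∀ {m} (D : Vec Bool m) → ∣ D ∣ ≡ ∑ m (bitAt D)
  card-∑ [] = refl
  card-∑ (true ∷ D) = cong suc (card-∑ D)
  card-∑ (false ∷ D) = card-∑ D

  bitAt-lookup : ∀ {m} (D : Vec Bool m) (i : Fin m) → bitAt D (toℕ i) ≡ bit (lookup D i)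
  bitAt-lookup (b ∷ D) Fin.zero = refl
  bitAt-lookup (b ∷ D) (Fin.suc i) = bitAt-lookup D i

module CycleGeometry (n : ℕ) {{_ : NonZero n}} where

  infix 4 _≈_
  record _≈_ (a b : ℕ) : Set where
    constructor mk≈
    field un : a % n ≡ b % n
  open _≈_ public

  ≈-sym : ∀ {a b} → a ≈ b → b ≈ a
  ≈-sym (mk≈ e) = mk≈ (sym e)

  ≈-trans : ∀ {a b c} → a ≈ b → b ≈ c → a ≈ c
  ≈-trans (mk≈ e) (mk≈ f) = mk≈ (trans e f)

  ≈-≡ : ∀ {a b} → a ≡ b → a ≈ b
  ≈-≡ e = mk≈ (cong (_% n) e)

  ≈-+ : ∀ {a b} c → a ≈ b → a + c ≈ b + c
  ≈-+ {a} {b} c (mk≈ e) =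
    mk≈ (trans (%-distribˡ-+ a c n) (trans (cong (λ z → (z + c % n) % n) e) (sym (%-distribˡ-+ b c n))))

  ≈-kn : ∀ a q → a + q * n ≈ a
  ≈-kn a q = mk≈ ([m+kn]%n≡m%n a q n)

  ≈-n : ∀ a → a + n ≈ a
  ≈-n a = mk≈ ([m+n]%n≡m%n a n)

  ≈-mod : ∀ a → a % n ≈ a
  ≈-mod a = mk≈ (m%n%n≡m%n a n)

  -- translation is invertible modulo n (add c·n - c)
  ≈-cancel : ∀ {a b} c → a + c ≈ b + c → a ≈ b
  ≈-cancel {a} {b} c e = ≈-trans (≈-sym (undo a)) (≈-trans (≈-+ d e) (undo b))
    where
    d = c * n ∸ c
    undo : ∀ x → x + c + d ≈ x
    undo x = ≈-trans (≈-≡ (trans (+-assoc x c d) (cong (x +_) (m+[n∸m]≡n (m≤m*n c n))))) (≈-kn x c)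

  ≈-small : ∀ {a b} → a ≈ b → a < n → b < n → a ≡ b
  ≈-small {a} {b} (mk≈ e) a<n b<n = trans (sym (m<n⇒m%n≡m a<n)) (trans e (m<n⇒m%n≡m b<n))

  ≉0 : ∀ {d} → d ≈ 0 → 0 < d → d < n → ⊥
  ≉0 {suc d} e _ d<n with ≈-small e d<n (>-nonZero⁻¹ n)
  ... | ()

  vertex : ℕ → Fin n
  vertex x = fromℕ< (m%n<n x n)

  toℕ-vertex : ∀ x → toℕ (vertex x) ≡ x % n
  toℕ-vertex x = toℕ-fromℕ< (m%n<n x n)

  vertex-cong : ∀ {a b} → a ≈ b → vertex a ≡ vertex b
  vertex-cong {a} {b} (mk≈ e) = toℕ-injective (trans (toℕ-vertex a) (trans e (sym (toℕ-vertex b))))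

  vertex-inj : ∀ {a b} → vertex a ≡ vertex b → a ≈ b
  vertex-inj {a} {b} e = mk≈ (trans (sym (toℕ-vertex a)) (trans (cong toℕ e) (toℕ-vertex b)))

  vertex-toℕ : ∀ (i : Fin n) → vertex (toℕ i) ≡ i
  vertex-toℕ i = toℕ-injective (trans (toℕ-vertex (toℕ i)) (m<n⇒m%n≡m (toℕ<n i)))

  toℕ-vertex≈ : ∀ x → toℕ (vertex x) ≈ x
  toℕ-vertex≈ x = ≈-trans (≈-≡ (toℕ-vertex x)) (≈-mod x)

  G : Graph n
  G = Cycle n

  edge⇒ : ∀ {a b} → G a b → (toℕ a + 1 ≈ toℕ b) ⊎ (toℕ b + 1 ≈ toℕ a)
  edge⇒ {a} {b} (inj₁ e) = inj₁ (≈-trans (≈-≡ (+-comm (toℕ a) 1)) (≈-trans (≈-sym (≈-mod (suc (toℕ a)))) (≈-sym (≈-≡ e))))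
  edge⇒ {a} {b} (inj₂ e) = inj₂ (≈-trans (≈-≡ (+-comm (toℕ b) 1)) (≈-trans (≈-sym (≈-mod (suc (toℕ b)))) (≈-sym (≈-≡ e))))

  forward-edge : ∀ (x : Fin n) → G x (vertex (toℕ x + 1))
  forward-edge x = inj₁ (trans (toℕ-vertex (toℕ x + 1)) (cong (_% n) (+-comm (toℕ x) 1)))

  edge-sym : ∀ {a b} → G a b → G b a
  edge-sym (inj₁ e) = inj₂ e
  edge-sym (inj₂ e) = inj₁ e

  snoc : ∀ {ℓ x y z} → Walk G ℓ x y → G y z → Walk G (suc ℓ) x z
  snoc here e = step e here
  snoc (step e' w) e = step e' (snoc w e)

  reverse : ∀ {ℓ x y} → Walk G ℓ x y → Walk G ℓ y x
  reverse here = here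
  reverse (step e w) = snoc (reverse w) (edge-sym e)

  forward-walk : ∀ m (x : Fin n) → Walk G m x (vertex (toℕ x + m))
  forward-walk zero x = subst (Walk G 0 x) (sym (trans (vertex-cong (≈-≡ (+-identityʳ (toℕ x)))) (vertex-toℕ x))) here
  forward-walk (suc m) x =
    subst (Walk G (suc m) x) (vertex-cong e) (step (forward-edge x) (forward-walk m (vertex (toℕ x + 1))))
    where
    e : toℕ (vertex (toℕ x + 1)) + m ≈ toℕ x + suc m
    e = ≈-trans (≈-+ m (toℕ-vertex≈ (toℕ x + 1))) (≈-≡ (+-assoc (toℕ x) 1 m))

  Near : ℕ → ℕ → ℕ → Set
  Near ρ a b = Σ ℕ λ m → m ≤ ρ × (a + m ≈ b ⊎ b + m ≈ a)

  -- one edge changes the displacement by ±1 (the six cases of signs)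
  walk⇒near : ∀ {ℓ x y} → Walk G ℓ x y → Near ℓ (toℕ x) (toℕ y)
  walk⇒near {x = x} here = 0 , z≤n , inj₁ (≈-≡ (+-identityʳ (toℕ x)))
  walk⇒near {suc ℓ} {x} {y} (step {y = c} e w) with edge⇒ e | walk⇒near w
  ... | inj₁ e1 | m , m≤ , inj₁ e2 = suc m , s≤s m≤ , inj₁ (≈-trans (≈-≡ (sym (+-assoc (toℕ x) 1 m))) (≈-trans (≈-+ m e1) e2))
  ... | inj₁ e1 | zero , m≤ , inj₂ e2 = 1 , s≤s z≤n , inj₁ (≈-trans e1 (≈-trans (≈-sym e2) (≈-≡ (+-identityʳ (toℕ y)))))
  ... | inj₁ e1 | suc m , m≤ , inj₂ e2 = m , m≤n⇒m≤1+n (≤-trans (n≤1+n m) m≤) , inj₂ (≈-cancel 1 (≈-trans (≈-≡ (trans (+-assoc (toℕ y) m 1) (cong (toℕ y +_) (+-comm m 1)))) (≈-trans e2 (≈-sym e1))))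
  ... | inj₂ e1 | zero , m≤ , inj₁ e2 = 1 , s≤s z≤n , inj₂ (≈-trans (≈-+ 1 (≈-trans (≈-sym e2) (≈-≡ (+-identityʳ (toℕ c))))) e1)
  ... | inj₂ e1 | suc m , m≤ , inj₁ e2 = m , m≤n⇒m≤1+n (≤-trans (n≤1+n m) m≤) , inj₁ (≈-trans (≈-+ m (≈-sym e1)) (≈-trans (≈-≡ (+-assoc (toℕ c) 1 m)) e2))
  ... | inj₂ e1 | m , m≤ , inj₂ e2 = suc m , s≤s m≤ , inj₂ (≈-trans (≈-≡ (trans (cong (toℕ y +_) (+-comm 1 m)) (sym (+-assoc (toℕ y) m 1)))) (≈-trans (≈-+ 1 e2) e1))

  Within : ℕ → Fin n → Fin n → Set
  Within ρ = WithinDist G ρ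

  within⇒near : ∀ {ρ a b} → Within ρ a b → Near ρ (toℕ a) (toℕ b)
  within⇒near (ℓ , ℓ≤ , w) with walk⇒near w
  ... | m , m≤ , o = m , ≤-trans m≤ ℓ≤ , o

  near⇒within : ∀ {ρ a b} → Near ρ (toℕ a) (toℕ b) → Within ρ a b
  near⇒within {a = a} {b} (m , m≤ , inj₁ e) =
    m , m≤ , subst (Walk G m a) (trans (vertex-cong e) (vertex-toℕ b)) (forward-walk m a)
  near⇒within {a = a} {b} (m , m≤ , inj₂ e) =
    m , m≤ , reverse (subst (Walk G m b) (trans (vertex-cong e) (vertex-toℕ a)) (forward-walk m b))

-- PairCover separates neighbouring balls (whose windows differ exactly in
-- y and y + s); WindowCover gives nonemptiness and separates balls at
-- distance more than s.
module CycleCodes (k r : ℕ) where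

  n : ℕ
  n = suc (2 * k)

  open CycleGeometry n public

  r2 : ℕ
  r2 = 2 * r

  s : ℕ
  s = 2 * r + 1

  r≤r2 : r ≤ r2
  r≤r2 = m≤m+n r (r + 0)

  window⇒ : ∀ y z → Within r (vertex (y + r)) z → Σ ℕ λ m → m ≤ r2 × z ≡ vertex (y + m)
  window⇒ y z w with within⇒near w
  ... | m , m≤ , inj₁ e = r + m , +-monoʳ-≤ r (≤-trans m≤ (m≤m+n r 0)) ,
        sym (trans (vertex-cong (≈-trans (≈-≡ (sym (+-assoc y r m))) (≈-trans (≈-+ m (≈-sym (toℕ-vertex≈ (y + r)))) e))) (vertex-toℕ z))
  ... | m , m≤ , inj₂ e = r ∸ m , ≤-trans (m∸n≤m r m) r≤r2 ,
        sym (trans (vertex-cong (≈-cancel m (≈-trans (≈-≡ (trans (+-assoc y (r ∸ m) m) (cong (y +_) (m∸n+n≡m m≤)))) (≈-trans (≈-sym (toℕ-vertex≈ (y + r))) (≈-sym e))))) (vertex-toℕ z))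

  window⇐ : ∀ y m → m ≤ r2 → Within r (vertex (y + r)) (vertex (y + m))
  window⇐ y m m≤ with r ≤? m
  ... | yes r≤m = near⇒within (m ∸ r , ≤-trans (∸-monoˡ-≤ r m≤) (≤-reflexive (trans (m+n∸m≡n r (r + 0)) (+-identityʳ r))) ,
          inj₁ (≈-trans (≈-+ (m ∸ r) (toℕ-vertex≈ (y + r))) (≈-trans (≈-≡ (trans (+-assoc y r (m ∸ r)) (cong (y +_) (m+[n∸m]≡n r≤m)))) (≈-sym (toℕ-vertex≈ (y + m))))))
  ... | no r≰m = near⇒within (r ∸ m , m∸n≤m r m ,
          inj₂ (≈-trans (≈-+ (r ∸ m) (toℕ-vertex≈ (y + m))) (≈-trans (≈-≡ (trans (+-assoc y m (r ∸ m)) (cong (y +_) (m+[n∸m]≡n (≰⇒≥ r≰m))))) (≈-sym (toℕ-vertex≈ (y + r))))))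

  InCode : Subset n → ℕ → Set
  InCode D x = lookup D (vertex x) ≡ true

  PairCover : Subset n → Set
  PairCover D = ∀ y → InCode D y ⊎ InCode D (y + s)

  WindowCover : Subset n → Set
  WindowCover D = ∀ y → Σ ℕ λ m → m ≤ r2 × InCode D (y + m)

  ∈⇒InCode : ∀ {D x} → vertex x ∈ D → InCode D x
  ∈⇒InCode = []=⇒lookup

  InCode⇒∈ : ∀ {D x} → InCode D x → vertex x ∈ D
  InCode⇒∈ {D} {x} = lookup⇒[]= (vertex x) D

  ∈-at : ∀ {D z} x → z ∈ D → z ≡ vertex x → InCode D x
  ∈-at {D} x z∈ refl = ∈⇒InCode {D} {x} z∈

  DrEqual-sym : ∀ {D x y} → DrEqual G r D x y → DrEqual G r D y x
  DrEqual-sym deq z z∈ = mk⇔ (Equivalence.from (deq z z∈)) (Equivalence.to (deq z z∈))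

  -- If neither y nor y + s is in D, the balls around y + r and y + 1 + r
  -- see the same code vertices: their windows differ only in y and y + s.
  neighbour-balls-agree : ∀ D y → ¬ InCode D y → ¬ InCode D (y + s) →
    DrEqual G r D (vertex (y + r)) (vertex (suc y + r))
  neighbour-balls-agree D y y∉ ys∉ z z∈ = mk⇔ to from
    where
    to : Within r (vertex (y + r)) z → Within r (vertex (suc y + r)) z
    to w with window⇒ y z w
    ... | zero , _ , z≡ = ⊥-elim (y∉ (∈-at {D} y z∈ (trans z≡ (cong vertex (+-identityʳ y)))))
    ... | suc m , sm≤ , z≡ =
      subst (Within r (vertex (suc y + r))) (sym (trans z≡ (cong vertex (+-suc y m)))) (window⇐ (suc y) m (≤-trans (n≤1+n m) sm≤))
    from : Within r (vertex (suc y + r)) z → Within r (vertex (y + r)) z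
    from w with window⇒ (suc y) z w
    ... | m , m≤ , z≡ with m ≟ r2
    ... | yes refl = ⊥-elim (ys∉ (∈-at {D} (y + s) z∈ (trans z≡ (cong vertex (trans (sym (+-suc y r2)) (cong (y +_) (+-comm 1 r2)))))))
    ... | no m≢ = subst (Within r (vertex (y + r))) (sym (trans z≡ (cong vertex (sym (+-suc y m))))) (window⇐ y (suc m) (≤∧≢⇒< m≤ m≢))

  code⇒windowCover : ∀ D → IsIdCode G r D → WindowCover D
  code⇒windowCover D (nonempty , _) y with nonempty (vertex (y + r))
  ... | z , z∈ , w with window⇒ y z w
  ... | m , m≤ , z≡ = m , m≤ , ∈-at {D} (y + m) z∈ z≡

  -- For the converse direction and for PairCover the cycle must be long
  -- compared to the windows: k ≥ s.
  module _ (k≥s : 2 * r + 1 ≤ k) where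

    n-large : 4 * r + 3 ≤ n
    n-large = subst (_≤ n) (eq r) (s≤s (*-monoʳ-≤ 2 k≥s))
      where
      eq : ∀ r → suc (2 * (2 * r + 1)) ≡ 4 * r + 3
      eq = solve-∀

    s+s≤n : s + s ≤ n
    s+s≤n = ≤-trans (≤-reflexive (eq r)) (≤-trans (m≤m+n (4 * r + 2) 1) (≤-trans (≤-reflexive (+-assoc (4 * r) 2 1)) n-large))
      where
      eq : ∀ r → 2 * r + 1 + (2 * r + 1) ≡ 4 * r + 2
      eq = solve-∀

    s<n : s < n
    s<n = ≤-trans (≤-reflexive (+-comm 1 s)) (≤-trans (+-monoʳ-≤ s (m≤n+m 1 r2)) s+s≤n)

    r2<n : r2 < n
    r2<n = ≤-trans (s≤s (m≤m+n r2 1)) s<n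

    neighbours-distinct : ∀ y → vertex (y + r) ≢ vertex (suc y + r)
    neighbours-distinct y e = ≉0 (≈-sym (≈-cancel {0} {1} y (≈-cancel r (vertex-inj e)))) (s≤s z≤n) (≤-trans (s≤s (s≤s z≤n)) (≤-trans (s≤s (m≤n+m 1 r2)) s<n))

    -- neighbouring balls must be separated, which forces PairCover
    code⇒pairCover : ∀ D → IsIdCode G r D → PairCover D
    code⇒pairCover D (_ , separating) y with lookup D (vertex y) Bool.≟ true | lookup D (vertex (y + s)) Bool.≟ true
    ... | yes y∈ | _ = inj₁ y∈
    ... | no _ | yes ys∈ = inj₂ ys∈
    ... | no y∉ | no ys∉ = ⊥-elim (separating _ _ (neighbours-distinct y) (neighbour-balls-agree D y y∉ ys∉))

    -- Balls whose centres are d apart (1 ≤ d, d + s ≤ n) are separated.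
    -- For d ≤ s one of y, y + s lies in exactly one of the two windows;
    -- for d > s the two windows are disjoint.
    BallsSeparated : Subset n → ℕ → ℕ → Set
    BallsSeparated D y d = ¬ DrEqual G r D (vertex (y + r)) (vertex (y + d + r))

    separated-left : ∀ D y d → 1 ≤ d → d ≤ s → InCode D y → BallsSeparated D y d
    separated-left D y d 1≤d d≤s y∈ deq with window⇒ (y + d) (vertex y) (Equivalence.to (deq (vertex y) (InCode⇒∈ {D} {y} y∈)) y-in-first)
      where
      y-in-first : Within r (vertex (y + r)) (vertex y)
      y-in-first = subst (Within r (vertex (y + r))) (vertex-cong (≈-≡ (+-identityʳ y))) (window⇐ y 0 z≤n)
    ... | m , m≤ , e = ≉0 (≈-sym (≈-cancel {0} y (≈-trans (vertex-inj e) (≈-≡ (trans (+-assoc y d m) (+-comm y (d + m)))))))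
                         (≤-trans 1≤d (m≤m+n d m)) d+m<n
      where
      d+m<n : d + m < n
      d+m<n = ≤-trans (s≤s (+-mono-≤ d≤s m≤)) (≤-trans (≤-reflexive (trans (sym (+-suc s r2)) (cong (s +_) (+-comm 1 r2)))) s+s≤n)

    separated-right : ∀ D y d → 1 ≤ d → d ≤ s → InCode D (y + s) → BallsSeparated D y d
    separated-right D y d 1≤d d≤s ys∈ deq with window⇒ y (vertex (y + s)) (Equivalence.from (deq (vertex (y + s)) (InCode⇒∈ {D} {y + s} ys∈)) ys-in-second)
      where
      s∸d≤r2 : s ∸ d ≤ r2
      s∸d≤r2 = ≤-trans (∸-monoʳ-≤ s 1≤d) (≤-reflexive (trans (+-∸-assoc r2 (≤-refl {1})) (+-identityʳ r2)))
      ys-in-second : Within r (vertex (y + d + r)) (vertex (y + s))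
      ys-in-second = subst (Within r (vertex (y + d + r))) (cong vertex (trans (+-assoc y d (s ∸ d)) (cong (y +_) (m+[n∸m]≡n d≤s))))
                       (window⇐ (y + d) (s ∸ d) s∸d≤r2)
    ... | m , m≤ , e with ≈-small (≈-cancel y (≈-trans (≈-≡ (+-comm s y)) (≈-trans (vertex-inj e) (≈-≡ (+-comm y m))))) s<n (≤-trans (s≤s m≤) r2<n)
    ... | refl = ⊥-elim (1+n≰n (≤-trans (≤-reflexive (+-comm 1 r2)) m≤))

    separated-far : ∀ D → WindowCover D → ∀ y d → s < d → d + s ≤ n → BallsSeparated D y d
    separated-far D window y d s<d d+s≤n deq with window y
    ... | m , m≤ , ym∈ with window⇒ (y + d) (vertex (y + m)) (Equivalence.to (deq (vertex (y + m)) (InCode⇒∈ {D} {y + m} ym∈)) (window⇐ y m m≤))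
    ... | m' , m'≤ , e with ≈-small (≈-cancel y (≈-trans (≈-≡ (+-comm m y)) (≈-trans (vertex-inj e) (≈-≡ (trans (+-assoc y d m') (+-comm y (d + m'))))))) (≤-trans (s≤s m≤) r2<n) d+m'<n
      where
      d+m'<n : d + m' < n
      d+m'<n = ≤-trans (s≤s (+-monoʳ-≤ d m'≤)) (≤-trans (≤-reflexive (sym (+-suc d r2))) (≤-trans (+-monoʳ-≤ d (≤-reflexive (+-comm 1 r2))) d+s≤n))
    ... | m≡d+m' = <⇒≱ s<d (≤-trans (m≤m+n d m') (≤-trans (≤-reflexive (sym m≡d+m')) (≤-trans m≤ (m≤m+n r2 1))))

    separated : ∀ D → PairCover D → WindowCover D → ∀ y d → 1 ≤ d → d + s ≤ n → BallsSeparated D y d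
    separated D pair window y d 1≤d d+s≤n with d ≤? s | pair y
    ... | yes d≤s | inj₁ y∈ = separated-left D y d 1≤d d≤s y∈
    ... | yes d≤s | inj₂ ys∈ = separated-right D y d 1≤d d≤s ys∈
    ... | no d≰s | _ = separated-far D window y d (≰⇒> d≰s) d+s≤n

    r≤n : r ≤ n
    r≤n = ≤-trans r≤r2 (<⇒≤ r2<n)

    vertex-centre : ∀ (x : Fin n) → vertex (toℕ x + (n ∸ r) + r) ≡ x
    vertex-centre x = trans (vertex-cong (≈-trans (≈-≡ centre-eq) (≈-n (toℕ x)))) (vertex-toℕ x)
      where
      centre-eq : toℕ x + (n ∸ r) + r ≡ toℕ x + n
      centre-eq = trans (+-assoc (toℕ x) (n ∸ r) r) (cong (toℕ x +_) (m∸n+n≡m r≤n))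

    private
      rearrange : ∀ a u d r → a + u + d + r ≡ a + d + (u + r)
      rearrange = solve-∀

    -- Two vertices at positions a < b are separated: their centres differ
    -- by d = b - a or, going around the cycle, by n - d, and one of these
    -- two distances satisfies d + s ≤ n.
    separated-ordered : ∀ D → PairCover D → WindowCover D → ∀ (x x' : Fin n) → toℕ x < toℕ x' → ¬ DrEqual G r D x x'
    separated-ordered D pair window x x' a<b deq with (toℕ x' ∸ toℕ x) + s ≤? n
    ... | yes d+s≤n = separated D pair window y d (m<n⇒0<n∸m a<b) d+s≤n (subst₂ (DrEqual G r D) (sym (vertex-centre x)) (sym x'-centre) deq)
      where
      a = toℕ x ; b = toℕ x' ; d = b ∸ a ; y = a + (n ∸ r)
      x'-centre : vertex (y + d + r) ≡ x'
      x'-centre = trans (vertex-cong (≈-trans (≈-≡ (trans (rearrange a (n ∸ r) d r) (cong₂ _+_ (m+[n∸m]≡n (<⇒≤ a<b)) (m∸n+n≡m r≤n)))) (≈-n b))) (vertex-toℕ x')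
    ... | no d+s≰n = separated D pair window y' d' (m<n⇒0<n∸m d<n) d'+s≤n (subst₂ (DrEqual G r D) (sym (vertex-centre x')) (sym x-centre) (DrEqual-sym {D} {x} {x'} deq))
      where
      a = toℕ x ; b = toℕ x' ; d = b ∸ a ; y' = b + (n ∸ r) ; d' = n ∸ d
      d<n : d < n
      d<n = ≤-trans (s≤s (m∸n≤m b a)) (toℕ<n x')
      d'<s : d' < s
      d'<s = +-cancelˡ-< d _ _ (subst (_< d + s) (sym (m+[n∸m]≡n (<⇒≤ d<n))) (≰⇒> d+s≰n))
      d'+s≤n : d' + s ≤ n
      d'+s≤n = ≤-trans (+-monoˡ-≤ s (<⇒≤ d'<s)) s+s≤n
      b+d'≡a+n : b + d' ≡ a + n
      b+d'≡a+n = trans (cong (_+ d') (sym (m+[n∸m]≡n (<⇒≤ a<b)))) (trans (+-assoc a d d') (cong (a +_) (m+[n∸m]≡n (<⇒≤ d<n))))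
      x-centre : vertex (y' + d' + r) ≡ x
      x-centre = trans (vertex-cong (≈-trans (≈-≡ (trans (rearrange b (n ∸ r) d' r) (cong₂ _+_ b+d'≡a+n (m∸n+n≡m r≤n)))) (≈-trans (≈-n (a + n)) (≈-n a)))) (vertex-toℕ x)

    covers⇒code : ∀ D → PairCover D → WindowCover D → IsIdCode G r D
    covers⇒code D pair window = nonempty , separating
      where
      nonempty : ∀ x → DrNonempty G r D x
      nonempty x with window (toℕ x + (n ∸ r))
      ... | m , m≤ , im = vertex (toℕ x + (n ∸ r) + m) , InCode⇒∈ {D} {toℕ x + (n ∸ r) + m} im ,
                          subst (λ c → Within r c (vertex (toℕ x + (n ∸ r) + m))) (vertex-centre x) (window⇐ (toℕ x + (n ∸ r)) m m≤)
      separating : ∀ x y → ¬ x ≡ y → ¬ DrEqual G r D x y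
      separating x x' x≢x' deq with <-cmp (toℕ x) (toℕ x')
      ... | tri< lt _ _ = separated-ordered D pair window x x' lt deq
      ... | tri≈ _ eq _ = x≢x' (toℕ-injective eq)
      ... | tri> _ _ gt = separated-ordered D pair window x' x gt (DrEqual-sym {D} {x} {x'} deq)

-- If g divides s and n, the
-- residue class c (mod g) is an orbit of y ↦ y + s of odd length L = n/g;
-- pair counts all equal to 1 along it would force ind to alternate along an
-- odd cycle, so each class has a point of pair count ≥ 2:
--   2|D| ≥ g (L + 1).
module Counting (k r : ℕ) where
  open FiniteSums
  open Parity
  open BoundedSearch
  open Cardinality
  open CycleCodes k r

  ind : Subset n → ℕ → ℕ
  ind D y = bit (lookup D (vertex y))

  ind-≈ : ∀ D {x y} → x ≈ y → ind D x ≡ ind D y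
  ind-≈ D e = cong (λ z → bit (lookup D z)) (vertex-cong e)

  InCode⇒ind : ∀ D y → InCode D y → ind D y ≡ 1
  InCode⇒ind D y e = cong bit e

  card-ind : ∀ D → ∣ D ∣ ≡ ∑ n (ind D)
  card-ind D = trans (card-∑ D) (∑-cong n (λ x x<n →
    trans (cong (bitAt D) (sym (trans (toℕ-vertex x) (m<n⇒m%n≡m x<n)))) (bitAt-lookup D (vertex x))))

  card-tabulate : ∀ (f : ℕ → Bool) → ∣ tabulate {n = n} (λ i → f (toℕ i)) ∣ ≡ ∑ n (λ x → bit (f x))
  card-tabulate f = trans (card-ind _) (∑-cong n (λ x x<n →
    cong bit (trans (lookup∘tabulate (λ i → f (toℕ i)) (vertex x)) (cong f (trans (toℕ-vertex x) (m<n⇒m%n≡m x<n))))))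

  pairCount : Subset n → ℕ → ℕ
  pairCount D y = ind D y + ind D (y + s)

  pairCount-≈ : ∀ D {x y} → x ≈ y → pairCount D x ≡ pairCount D y
  pairCount-≈ D e = cong₂ _+_ (ind-≈ D e) (ind-≈ D (≈-+ s e))

  pairCount≥1 : ∀ D → PairCover D → ∀ y → 1 ≤ pairCount D y
  pairCount≥1 D pair y with pair y
  ... | inj₁ e = ≤-trans (≤-reflexive (sym (InCode⇒ind D y e))) (m≤m+n _ _)
  ... | inj₂ e = ≤-trans (≤-reflexive (sym (InCode⇒ind D (y + s) e))) (m≤n+m _ _)

  -- every vertex is counted twice (once as y, once as y + s)
  ∑-pairCount : ∀ D → ∑ n (pairCount D) ≡ 2 * ∣ D ∣
  ∑-pairCount D = begin
    ∑ n (pairCount D)                     ≡⟨ ∑-+ n (ind D) (λ y → ind D (y + s)) ⟩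
    ∑ n (ind D) + ∑ n (λ y → ind D (y + s)) ≡⟨ cong (∑ n (ind D) +_) (∑-shift n (ind D) (λ x → ind-≈ D (≈-n x)) s) ⟩
    ∑ n (ind D) + ∑ n (ind D)             ≡⟨ cong (λ z → z + z) (sym (card-ind D)) ⟩
    ∣ D ∣ + ∣ D ∣                         ≡⟨ cong (∣ D ∣ +_) (sym (+-identityʳ ∣ D ∣)) ⟩
    2 * ∣ D ∣                             ∎
    where open ≡-Reasoning

  n≡k+k : n ≡ suc (k + k)
  n≡k+k = cong (λ z → suc (k + z)) (+-identityʳ k)

  odd-cofactor : ∀ g L → L * g ≡ n → Σ ℕ λ a → L ≡ suc (a + a)
  odd-cofactor g L Lg with even-or-odd L
  ... | a , inj₂ e = a , e
  ... | a , inj₁ e = ⊥-elim (double≢odd (a * g) k (trans (sym (*-distribʳ-+ g a a)) (trans (cong (_* g) (sym e)) (trans Lg n≡k+k))))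

  module _ (D : Subset n) (pair : PairCover D) (g : ℕ) {{_ : NonZero g}}
           (L : ℕ) (Lg : L * g ≡ n) (g∣s : g ∣ s) where

    g∣n : g ∣ n
    g∣n = divides L (sym Lg)

    orbit : ℕ → ℕ → ℕ
    orbit c j = ind D (c + j * s)

    -- the orbit closes up after L steps, since L·s is a multiple of n
    orbit-closes : ∀ c → orbit c L ≡ orbit c 0
    orbit-closes c = ind-≈ D (≈-trans (≈-≡ (cong (c +_) Ls≡s'n)) (≈-trans (≈-kn c s') (≈-≡ (sym (+-identityʳ c)))))
      where
      s' = s / g
      Ls≡s'n : L * s ≡ s' * n
      Ls≡s'n = begin
        L * s          ≡⟨ cong (L *_) (sym (m/n*n≡m g∣s)) ⟩
        L * (s' * g)   ≡⟨ solve-∀′ L s' g ⟩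
        s' * (L * g)   ≡⟨ cong (s' *_) Lg ⟩
        s' * n         ∎
        where
        open ≡-Reasoning
        solve-∀′ : ∀ L s' g → L * (s' * g) ≡ s' * (L * g)
        solve-∀′ = solve-∀

    orbit-alternates : ∀ c → c < g → (∀ b → b < L → ¬ 2 ≤ pairCount D (b * g + c)) →
      ∀ j → orbit c j + orbit c (suc j) ≡ 1
    orbit-alternates c c<g none j =
      ≤-antisym (≤-trans (≤-reflexive (cong (λ z → orbit c j + ind D z) (sym next))) (class≤1 (c + j * s) in-class))
                (≤-trans (pairCount≥1 D pair (c + j * s)) (≤-reflexive (cong (λ z → orbit c j + ind D z) next)))
      where
      next : c + j * s + s ≡ c + suc j * s
      next = trans (+-assoc c (j * s) s) (cong (c +_) (+-comm (j * s) s))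
      in-class : (c + j * s) % g ≡ c
      in-class = trans (%-remove-+ʳ c (∣n⇒∣m*n j g∣s)) (m<n⇒m%n≡m c<g)
      class≤1 : ∀ y → y % g ≡ c → pairCount D y ≤ 1
      class≤1 y y%g = ≤-trans (≤-reflexive (trans (pairCount-≈ D (≈-sym (≈-mod y))) (cong (pairCount D) y≡)))
                              (s≤s⁻¹ (≰⇒> (none b b<L)))
        where
        b = (y % n) / g
        b<L : b < L
        b<L = m<n*o⇒m/o<n (subst (y % n <_) (sym Lg) (m%n<n y n))
        y≡ : y % n ≡ b * g + c
        y≡ = trans (m≡m%n+[m/n]*n (y % n) g) (trans (cong (_+ b * g) (trans (m∣n⇒o%n%m≡o%m g n y g∣n) y%g)) (+-comm c (b * g)))

    L-odd : Σ ℕ λ a → L ≡ suc (a + a)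
    L-odd = odd-cofactor g L Lg

    class-has-double : ∀ c → c < g → Σ ℕ λ b → b < L × 2 ≤ pairCount D (b * g + c)
    class-has-double c c<g with search L (λ b → 2 ≤ pairCount D (b * g + c)) (λ b → 2 ≤? pairCount D (b * g + c))
    ... | inj₁ found = found
    ... | inj₂ none = ⊥-elim (alternating-odd (orbit c) (orbit-alternates c c<g none) a
                                (trans (cong (orbit c) (sym L≡)) (orbit-closes c)))
      where
      a = proj₁ L-odd
      L≡ = proj₂ L-odd

    -- every one of the g classes has L points of pair count ≥ 1 and one of ≥ 2
    pairCount-bound : g * suc L ≤ 2 * ∣ D ∣
    pairCount-bound = begin
      g * suc L                                       ≡⟨ sym (∑-const g (suc L)) ⟩
      ∑ g (λ _ → suc L)                               ≤⟨ ∑-mono g class-bound ⟩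
      ∑ g (λ c → ∑ L (λ b → pairCount D (b * g + c))) ≡⟨ sym (∑-swap L g (λ b c → pairCount D (b * g + c))) ⟩
      ∑ L (λ b → ∑ g (λ c → pairCount D (b * g + c))) ≡⟨ sym (∑-blocks L g (pairCount D)) ⟩
      ∑ (L * g) (pairCount D)                         ≡⟨ cong (λ m → ∑ m (pairCount D)) Lg ⟩
      ∑ n (pairCount D)                               ≡⟨ ∑-pairCount D ⟩
      2 * ∣ D ∣                                       ∎
      where
      open ≤-Reasoning
      class-bound : ∀ c → c < g → suc L ≤ ∑ L (λ b → pairCount D (b * g + c))
      class-bound c c<g with class-has-double c c<g
      ... | b₀ , b₀<L , two = ∑-positive+1 L (λ b _ → pairCount≥1 D pair (b * g + c)) b₀ b₀<L two

  -- If n, s are coprime and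
  -- 2|D| ≤ n + 1, the counting argument leaves exactly one point y₀ of pair
  -- count 2, and ind alternates along the orbit of y₀ under y ↦ y + s.
  -- When q = 0 or q = 2r this exhibits a window missing D; so in those
  -- cases every r-identifying code has at least k + 2 elements.
  module SharpBound (D : Subset n) (pair : PairCover D) (window : WindowCover D)
                    (coprime : ∀ i → n ∣ i * s → n ∣ i) (small : 2 * ∣ D ∣ ≤ suc n) where

    -- the (g = 1) counting argument provides a point of pair count 2 …
    first-double : Σ ℕ λ b → b < n × 2 ≤ pairCount D (b * 1 + 0)
    first-double = class-has-double D pair 1 n (*-identityʳ n) (divides s (sym (*-identityʳ s))) 0 (s≤s z≤n)

    y₀ : ℕ
    y₀ = proj₁ first-double

    y₀<n : y₀ < n
    y₀<n = proj₁ (proj₂ first-double)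

    y₀-double : 2 ≤ pairCount D y₀
    y₀-double = subst (λ z → 2 ≤ pairCount D z) (trans (+-identityʳ (y₀ * 1)) (*-identityʳ y₀)) (proj₂ (proj₂ first-double))

    -- … and, as 2|D| ≤ n + 1, it is the only one

    unique-double : ∀ y → y < n → y ≢ y₀ → pairCount D y ≤ 1
    unique-double y y<n ne with 2 ≤? pairCount D y
    ... | no ¬2 = s≤s⁻¹ (≰⇒> ¬2)
    ... | yes y2 = ⊥-elim (1+n≰n (≤-trans (∑-positive+2 n (λ x _ → pairCount≥1 D pair x) y y₀ y<n y₀<n ne y2 y₀-double) (≤-trans (≤-reflexive (∑-pairCount D)) small)))

    -- ind along the orbit y₀, y₀ + s, y₀ + 2s, …; it visits every vertex
    -- before returning to y₀, because n and s are coprime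
    trail : ℕ → ℕ
    trail i = ind D (y₀ + i * s)

    -- off y₀ the pair counts are 1, so consecutive trail values sum to 1
    trail-alternates : ∀ i → 1 ≤ i → i < n → trail i + trail (suc i) ≡ 1
    trail-alternates i 1≤i i<n = ≤-antisym (≤-trans (≤-reflexive (trans (cong (λ z → trail i + ind D z) (sym eq)) (pairCount-≈ D {y₀ + i * s} {(y₀ + i * s) % n} (≈-sym (≈-mod (y₀ + i * s)))))) (unique-double ((y₀ + i * s) % n) (m%n<n (y₀ + i * s) n) ne))
                               (≤-trans (pairCount≥1 D pair (y₀ + i * s)) (≤-reflexive (cong (λ z → trail i + ind D z) eq)))
      where
      eq : y₀ + i * s + s ≡ y₀ + suc i * s
      eq = trans (+-assoc y₀ (i * s) s) (cong (y₀ +_) (+-comm (i * s) s))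
      -- n ∣ i·s forces n ∣ i, impossible for 0 < i < n
      ne : (y₀ + i * s) % n ≢ y₀
      ne e' with coprime i (m%n≡0⇒n∣m (i * s) n (un (≈-cancel {i * s} {0} y₀ (≈-trans (≈-≡ (+-comm (i * s) y₀)) (mk≈ (trans e' (sym (m<n⇒m%n≡m y₀<n))))))))
      ... | divides zero i≡0 = <⇒≢ 1≤i (sym i≡0)
      ... | divides (suc c) i≡ = <⇒≱ i<n (≤-trans (m≤m+n n (c * n)) (≤-reflexive (sym i≡)))

    -- pair count 2 at y₀ means y₀ + s ∈ D
    trail-1 : trail 1 ≡ 1
    trail-1 = ≤-antisym (bit≤1 _) (+-cancelˡ-≤ 1 1 (trail 1) (≤-trans y₀-double (+-mono-≤ (bit≤1 _) (≤-reflexive (cong (λ z → ind D (y₀ + z)) (sym (+-identityʳ s)))))))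

    trail-odd-even : ∀ j → 2 * j + 2 ≤ n → trail (suc (j + j)) ≡ 1 × trail (suc (suc (j + j))) ≡ 0
    trail-odd-even zero 2≤n = trail-1 , +-cancelˡ-≡ 1 _ _ (trans (cong (_+ trail 2) (sym trail-1)) (trail-alternates 1 ≤-refl (≤-trans (s≤s (s≤s z≤n)) 2≤n)))
    trail-odd-even (suc j) le with trail-odd-even j (≤-trans (+-monoˡ-≤ 2 (*-monoʳ-≤ 2 (n≤1+n j))) le)
    ... | c1 , c2 = o1 , o2
      where
      ss = suc (suc (j + j))
      le' : suc (suc ss) ≤ n
      le' = subst (_≤ n) (eq j) le
        where
        eq : ∀ j → 2 * suc j + 2 ≡ suc (suc (suc (suc (j + j))))
        eq = solve-∀
      o1' : trail (suc ss) ≡ 1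
      o1' = trans (sym (+-identityˡ (trail (suc ss)))) (trans (cong (_+ trail (suc ss)) (sym c2)) (trail-alternates ss (s≤s z≤n) (≤-trans (n≤1+n (suc ss)) le')))
      o2' : trail (suc (suc ss)) ≡ 0
      o2' = +-cancelˡ-≡ 1 _ _ (trans (cong (_+ trail (suc (suc ss))) (sym o1')) (trans (trail-alternates (suc ss) (s≤s z≤n) le') (sym (+-identityʳ 1))))
      o1 : trail (suc (suc j + suc j)) ≡ 1
      o1 = trans (cong (λ z → trail (suc (suc z))) (+-suc j j)) o1'
      o2 : trail (suc (suc (suc j + suc j))) ≡ 0
      o2 = trans (cong (λ z → trail (suc (suc (suc z)))) (+-suc j j)) o2'

    trail-even-empty : ∀ j → 1 ≤ j → j ≤ k → trail (j + j) ≡ 0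
    trail-even-empty (suc j) _ j≤k = trans (cong trail (+-suc (suc j) j)) (proj₂ (trail-odd-even j (≤-trans (≤-reflexive (eq j)) (≤-trans (n≤1+n _) (≤-trans (s≤s (+-mono-≤ j≤k j≤k)) (≤-reflexive (sym n≡k+k)))))))
      where
      eq : ∀ j → 2 * j + 2 ≡ suc j + suc j
      eq = solve-∀

    private
      empty-window-q≡0 : ∀ t p s → t * (p + p) * s + t ≡ t * suc (2 * (s * p + 0))
      empty-window-q≡0 = solve-∀
      empty-window-q≡2r : ∀ m p r → (suc (m * suc p) + suc (m * suc p)) * (2 * r + 1) ≡ (2 * r + 1) + (2 * r + 1) + m + m * suc (2 * ((2 * r + 1) * p + 2 * r))
      empty-window-q≡2r = solve-∀
      k-when-q≡2r : ∀ p' r → (2 * r + 1) * suc p' + 2 * r ≡ suc (2 * r * suc (suc p')) + p'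
      k-when-q≡2r = solve-∀

    -- If k = s·p, the window y₀ - s, …, y₀ - 1 consists of vertices
    -- y₀ + 2j·s with j = (s - m)·p; hence it misses D.
    no-code-when-q≡0 : ∀ p → k ≡ s * p + 0 → 1 ≤ p → ⊥
    no-code-when-q≡0 p k≡ 1≤p with window (y₀ + (n ∸ s))
    ... | m , m≤ , im = 1≢0 (trans (sym (InCode⇒ind D (y₀ + (n ∸ s) + m) im)) (trans (ind-≈ D eqx) (trans (cong trail (*-distribˡ-+ t p p)) (trail-even-empty (t * p) 1≤j j≤k))))
      where
      1≢0 : 1 ≢ 0
      1≢0 ()
      t = s ∸ m
      m<s : m < s
      m<s = ≤-trans (s≤s m≤) (≤-reflexive (+-comm 1 r2))
      s≤n : s ≤ n
      s≤n = ≤-trans (≤-reflexive (sym (*-identityʳ s))) (≤-trans (*-monoʳ-≤ s 1≤p) (≤-trans (m≤m+n (s * p) 0) (≤-trans (≤-reflexive (sym k≡)) (≤-trans (m≤m+n k (k + 0)) (n≤1+n _)))))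
      1≤t : 1 ≤ t
      1≤t = m<n⇒0<n∸m m<s
      t≤s : t ≤ s
      t≤s = m∸n≤m s m
      1≤j : 1 ≤ t * p
      1≤j = *-mono-≤ 1≤t 1≤p
      j≤k : t * p ≤ k
      j≤k = ≤-trans (*-monoˡ-≤ p t≤s) (≤-trans (m≤m+n (s * p) 0) (≤-reflexive (sym k≡)))
      eqx : y₀ + (n ∸ s) + m ≈ y₀ + t * (p + p) * s
      eqx = ≈-cancel t (≈-trans (≈-≡ l1) (≈-trans (≈-n y₀) (≈-sym (≈-trans (≈-≡ l2) (≈-kn y₀ t)))))
        where
        l1 : y₀ + (n ∸ s) + m + t ≡ y₀ + n
        l1 = trans (+-assoc (y₀ + (n ∸ s)) m t) (trans (cong (y₀ + (n ∸ s) +_) (m+[n∸m]≡n (<⇒≤ m<s))) (trans (+-assoc y₀ (n ∸ s) s) (cong (y₀ +_) (m∸n+n≡m s≤n))))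
        l2 : y₀ + t * (p + p) * s + t ≡ y₀ + t * n
        l2 = trans (+-assoc y₀ (t * (p + p) * s) t) (cong (y₀ +_) (trans (empty-window-q≡0 t p s) (cong (λ z → t * suc (2 * z)) (sym k≡))))

    -- If k = s·p + 2r, the window starting at y₀ + 2s consists of vertices
    -- y₀ + 2j·s with j = 1 + m·(p + 1); hence it misses D.
    no-code-when-q≡2r : ∀ p → k ≡ s * p + r2 → 1 ≤ p → ⊥
    no-code-when-q≡2r (suc p') k≡ _ with window (y₀ + (s + s))
    ... | m , m≤ , im = 1≢0 (trans (sym (InCode⇒ind D (y₀ + (s + s) + m) im)) (trans (ind-≈ D eqx) (trail-even-empty j (s≤s z≤n) j≤k)))
      where
      1≢0 : 1 ≢ 0
      1≢0 ()
      p = suc p'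
      j = suc (m * suc p)
      j≤k : j ≤ k
      j≤k = ≤-trans (s≤s (*-monoˡ-≤ (suc p) m≤)) (≤-trans (m≤m+n _ p') (≤-reflexive (sym (trans k≡ (k-when-q≡2r p' r)))))
      eqx : y₀ + (s + s) + m ≈ y₀ + (j + j) * s
      eqx = ≈-sym (≈-trans (≈-≡ (trans (cong (y₀ +_) (trans (empty-window-q≡2r m p r) (cong (λ z → s + s + m + m * suc (2 * z)) (sym k≡)))) (trans (sym (+-assoc y₀ (s + s + m) (m * n))) (cong (_+ m * n) (sym (+-assoc y₀ (s + s) m)))))) (≈-kn (y₀ + (s + s) + m) m))

module Part4 (K σ : ℕ) where

module ProgressionCodes (K σ : ℕ) where
  open FiniteSums

  M : ℕ
  M = suc (2 * K)
  t : ℕ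
  t = σ + σ

  isZero : ℕ → Bool
  isZero zero = true
  isZero (suc _) = false

  divisible : ℕ → Bool
  divisible x = isZero (x % M)

  divisible⇒∣ : ∀ {x} → divisible x ≡ true → M ∣ x
  divisible⇒∣ {x} e = m%n≡0⇒n∣m x M (isZero-sound (x % M) e)
    where
    isZero-sound : ∀ y → isZero y ≡ true → y ≡ 0
    isZero-sound zero _ = refl
    isZero-sound (suc y) ()

  ∣⇒divisible : ∀ {x} → M ∣ x → divisible x ≡ true
  ∣⇒divisible {x} d = cong isZero (n∣m⇒m%n≡0 x M d)

  divisible-periodic : ∀ x → divisible (x + M) ≡ divisible x
  divisible-periodic x = cong isZero ([m+n]%n≡m%n x M)

  progression : ℕ → ℕ → Bool
  progression zero b = divisible b
  progression (suc J) b = progression J b ∨ divisible (b + suc J * t)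

  ∨-true : ∀ {a b} → a ∨ b ≡ true → a ≡ true ⊎ b ≡ true
  ∨-true {true} _ = inj₁ refl
  ∨-true {false} e = inj₂ e

  progression-sound : ∀ J b → progression J b ≡ true → Σ ℕ λ j → j ≤ J × M ∣ b + j * t
  progression-sound zero b e = 0 , z≤n , subst (M ∣_) (sym (+-identityʳ b)) (divisible⇒∣ e)
  progression-sound (suc J) b e with ∨-true {progression J b} e
  ... | inj₁ e1 = let (j , j≤ , d) = progression-sound J b e1 in j , m≤n⇒m≤1+n j≤ , d
  ... | inj₂ e2 = suc J , ≤-refl , divisible⇒∣ e2

  progression-complete : ∀ J b j → j ≤ J → M ∣ b + j * t → progression J b ≡ true
  progression-complete zero b .zero z≤n d = ∣⇒divisible (subst (M ∣_) (+-identityʳ b) d)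
  progression-complete (suc J) b j j≤ d with m≤n⇒m<n∨m≡n j≤
  ... | inj₁ lt = cong (_∨ divisible (b + suc J * t)) (progression-complete J b j (s≤s⁻¹ lt) d)
  ... | inj₂ refl = trans (cong (progression J b ∨_) (∣⇒divisible d)) (∨-zeroʳ (progression J b))

  progression-periodic : ∀ J b → progression J (b + M) ≡ progression J b
  progression-periodic zero b = divisible-periodic b
  progression-periodic (suc J) b = cong₂ _∨_ (progression-periodic J b) (trans (cong divisible (trans (+-assoc b M _) (trans (cong (b +_) (+-comm M _)) (sym (+-assoc b _ M))))) (divisible-periodic (b + suc J * t)))

  ∑-divisible : ∀ c → ∑ M (λ b → bit (divisible (b + c))) ≡ 1
  ∑-divisible c = trans (∑-shift M (λ b → bit (divisible b)) (λ x → cong bit (divisible-periodic x)) c)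
    (∑-single M {λ b → bit (divisible b)} 0 (s≤s z≤n) (λ { zero _ ne → ⊥-elim (ne refl) ; (suc x) x<M _ → cong (λ z → bit (isZero z)) (m<n⇒m%n≡m x<M) }))

  module CoprimeModulus (coprime : ∀ i → M ∣ i * t → M ∣ i) where

    -- the J + 1 residues -j·t (j ≤ J < M) are pairwise distinct
    progression-size : ∀ J → J < M → ∑ M (λ b → bit (progression J b)) ≡ suc J
    progression-size zero _ = trans (∑-cong M (λ b _ → cong (λ z → bit (divisible z)) (sym (+-identityʳ b)))) (∑-divisible 0)
    progression-size (suc J) J<M = trans (∑-cong M (λ b _ → bit-∨ (progression J b) (divisible (b + suc J * t)) (disj b)))
        (trans (∑-+ M (λ b → bit (progression J b)) (λ b → bit (divisible (b + suc J * t)))) (trans (cong₂ _+_ (progression-size J (≤-trans (n≤1+n _) J<M)) (∑-divisible (suc J * t))) (+-comm (suc J) 1)))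
      where
      disj : ∀ b → progression J b ≡ true → divisible (b + suc J * t) ≡ true → ⊥
      disj b e1 e2 with progression-sound J b e1
      ... | j , j≤ , d1 = ⊥-elim (<⇒≱ (≤-trans (s≤s (m∸n≤m (suc J) j)) J<M) (∣⇒≤ {{nz}} (coprime (suc J ∸ j) (∣m+n∣m⇒∣n (subst (M ∣_) eq (divisible⇒∣ e2)) d1))))
        where
        eq : b + suc J * t ≡ b + j * t + (suc J ∸ j) * t
        eq = trans (cong (λ z → b + z * t) (sym (m+[n∸m]≡n (m≤n⇒m≤1+n j≤)))) (trans (cong (b +_) (*-distribʳ-+ t j (suc J ∸ j))) (sym (+-assoc b _ _)))
        nz : NonZero (suc J ∸ j)
        nz = >-nonZero (m<n⇒0<n∸m (s≤s j≤))

    -- with J = 2K all M residues are reached: every b has an index j < M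
    reaches-every-residue : ∀ b → Σ ℕ λ j → j < M × M ∣ b + j * t
    reaches-every-residue b with progression-sound (2 * K) (b % M) (bit1 (∑-all-one M (λ x → bit (progression (2 * K) x)) (λ x _ → bit≤1 _) (progression-size (2 * K) ≤-refl) (b % M) (m%n<n b M)))
      where
      bit1 : ∀ {a} → bit a ≡ 1 → a ≡ true
      bit1 {true} _ = refl
      bit1 {false} ()
    ... | j , j≤ , d = j , s≤s j≤ , d'
      where
      d' : M ∣ b + j * t
      d' = subst (M ∣_) (trans (rr (b % M) (j * t) ((b / M) * M)) (cong (_+ j * t) (sym (m≡m%n+[m/n]*n b M)))) (∣m∣n⇒∣m+n d (∣n⇒∣m*n (b / M) (n∣n {M})))
        where
        rr : ∀ a c d → a + c + d ≡ a + d + c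
        rr = solve-∀

    -- The pair property for shift σ: if b = -j·t with j > K, then
    -- b + σ = -(j - K - 1)·t since (K + 1)·t ≡ σ (mod M).
    progression-pairCover : ∀ b → progression K b ≡ true ⊎ progression K (b + σ) ≡ true
    progression-pairCover b with reaches-every-residue b
    ... | j , j<M , d with j ≤? K
    ... | yes j≤K = inj₁ (progression-complete K b j j≤K d)
    ... | no j≰K = inj₂ (progression-complete K (b + σ) j' j'≤ d')
      where
      j' = j ∸ suc K
      eqj : j ≡ suc K + j'
      eqj = sym (m+[n∸m]≡n (≰⇒> j≰K))
      j'≤ : j' ≤ K
      j'≤ = +-cancelˡ-≤ (suc K) _ _ (≤-trans (≤-reflexive (sym eqj)) (≤-trans (s≤s⁻¹ j<M) (≤-trans (≤-reflexive (cong (K +_) (+-identityʳ K))) (n≤1+n (K + K)))))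
      d' : M ∣ b + σ + j' * t
      d' = ∣m+n∣m⇒∣n {M} {_} (subst (M ∣_) (ideq b σ K j') (subst (λ z → M ∣ b + z * t) eqj d)) (∣n⇒∣m*n σ (n∣n {M}))
        where
        ideq : ∀ b σ K j' → b + (suc K + j') * (σ + σ) ≡ σ * suc (2 * K) + (b + σ + j' * (σ + σ))
        ideq = solve-∀

-- Every y has an index a(y) ∈ [0, 2k] with y ≡ -a(y)·2s (mod n), and
-- y ∈ P_k iff a(y) ≤ k.
module WindowProperty (k r : ℕ) where
  open Parity
  open BoundedSearch
  open CycleCodes k r using (n; s; r2)
  open ProgressionCodes k (2 * r + 1) using (progression; progression-complete; t; module CoprimeModulus)

  -- index steps: a(y) = a(y + 1) + e needs e·t ≡ 1, and
  -- a(y + 1) = a(y) + e needs e·t ≡ -1 (mod n)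
  StepDown StepUp : ℕ → Set
  StepDown e = n ∣ e * t + 2 * k
  StepUp e = n ∣ e * t + 1

  not-between-multiples : ∀ e p w → e * s ≡ s * p + w → 1 ≤ w → w < s → ⊥
  not-between-multiples e p w eq 1≤w w<s with e ≤? p
  ... | yes e≤p = <⇒≱ lt (≤-trans (*-monoˡ-≤ s e≤p) (≤-reflexive (*-comm p s)))
    where
    lt : s * p < e * s
    lt = ≤-trans (≤-reflexive (+-comm 1 (s * p))) (≤-trans (+-monoʳ-≤ (s * p) 1≤w) (≤-reflexive (sym eq)))
  ... | no e≰p = <⇒≱ (subst (_< s * p + s) (sym eq) (+-monoʳ-< (s * p) w<s)) (≤-trans (≤-reflexive (trans (+-comm (s * p) s) (cong (s +_) (*-comm s p)))) (*-monoˡ-≤ s (≰⇒> e≰p)))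

  module _ (coprime : ∀ i → n ∣ i * t → n ∣ i) (p q : ℕ) (k≡ : k ≡ s * p + q)
           (q≤ : q ≤ r2) (q≢0 : q ≢ 0) (q≢r2 : q ≢ r2) (1≤r : 1 ≤ r) where
    open CoprimeModulus coprime

    private
      t-expand : ∀ e r → e * ((2 * r + 1) + (2 * r + 1)) ≡ (2 * r * e + e) + (2 * r * e + e)
      t-expand = solve-∀
      t-split : ∀ e r → e * ((2 * r + 1) + (2 * r + 1)) ≡ e * (2 * r + 1) + e * (2 * r + 1)
      t-split = solve-∀
      one-n : ∀ k → 1 * suc (2 * k) ≡ 1 + 2 * k
      one-n = solve-∀
      two-n : ∀ k → 2 * suc (2 * k) ≡ (2 * k + 2) + 2 * k
      two-n = solve-∀
      two-n′ : ∀ k → 2 * suc (2 * k) ≡ suc (4 * k) + 1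
      two-n′ = solve-∀
      three-n : ∀ k → 3 * suc (2 * k) ≡ suc (4 * k + 2 * k) + 2
      three-n = solve-∀
      double-k+1 : ∀ k → 2 * k + 2 ≡ (k + 1) + (k + 1)
      double-k+1 = solve-∀
      double-k : ∀ k → 2 * k ≡ k + k
      double-k = solve-∀
      k≡-suc : ∀ s p q → s * p + q + 1 ≡ s * p + (q + 1)
      k≡-suc = solve-∀

    -- Steps that are small compared with k are impossible when
    -- q ∉ {0, 2r}: comparing e·t + 2k resp. e·t + 1 with 0, n, 2n leaves
    -- e·s strictly between consecutive multiples of s.
    small-step-bound : ∀ e → r2 * e + 1 ≤ k → e * t + 4 ≤ 4 * k
    small-step-bound e le = ≤-trans (≤-reflexive (cong (_+ 4) (t-expand e r))) (≤-trans (+-monoˡ-≤ 4 (+-mono-≤ (+-monoʳ-≤ (r2 * e) e≤) (+-monoʳ-≤ (r2 * e) e≤))) (≤-trans (≤-reflexive (eq4 (r2 * e))) (*-monoʳ-≤ 4 le)))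
      where
      e≤ : e ≤ r2 * e
      e≤ = ≤-trans (≤-reflexive (sym (*-identityˡ e))) (*-monoˡ-≤ e (≤-trans 1≤r (m≤m+n r (r + 0))))
      eq4 : ∀ z → z + z + (z + z) + 4 ≡ 4 * (z + 1)
      eq4 = solve-∀

    quotient<3 : ∀ c Y → Y ≡ c * n → Y < 3 * n → c ≡ 0 ⊎ c ≡ 1 ⊎ c ≡ 2
    quotient<3 zero Y _ _ = inj₁ refl
    quotient<3 (suc zero) Y _ _ = inj₂ (inj₁ refl)
    quotient<3 (suc (suc zero)) Y _ _ = inj₂ (inj₂ refl)
    quotient<3 (suc (suc (suc c))) Y eq lt = ⊥-elim (<⇒≱ lt (≤-trans (≤-reflexive (eq3 n)) (≤-trans (m≤m+n (3 * n) (c * n)) (≤-reflexive (trans (eq4 n c) (sym eq))))))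
      where
      eq3 : ∀ n → 3 * n ≡ n + (n + (n + 0))
      eq3 = solve-∀
      eq4 : ∀ n c → 3 * n + c * n ≡ n + (n + (n + c * n))
      eq4 = solve-∀

    k≥1 : ∀ e → r2 * e + 1 ≤ k → 1 ≤ k
    k≥1 e le = ≤-trans (m≤n+m 1 (r2 * e)) le

    q+1<s : q + 1 < s
    q+1<s = +-monoˡ-< 1 (≤∧≢⇒< q≤ q≢r2)
    q<s : q < s
    q<s = ≤-trans (s≤s q≤) (≤-reflexive (+-comm 1 r2))

    -- e·t + 2k ∈ {0, n, 2n}: not 0 as k ≥ 1; n would make 2·e·s odd; 2n
    -- gives e·s = k + 1 = s·p + (q + 1) with 0 < q + 1 < s
    no-small-step-down : ∀ e → r2 * e + 1 ≤ k → StepDown e → ⊥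
    no-small-step-down e le (divides c eq) with quotient<3 c _ eq lt
      where
      lt : e * t + 2 * k < 3 * n
      lt = ≤-trans (s≤s (+-monoˡ-≤ (2 * k) (≤-trans (m≤m+n (e * t) 4) (small-step-bound e le)))) (≤-trans (m≤m+n _ 2) (≤-reflexive (sym (three-n k))))
    ... | inj₁ refl = <⇒≱ (≤-trans (s≤s z≤n) (*-monoʳ-≤ 2 (k≥1 e le))) (≤-reflexive (m+n≡0⇒n≡0 (e * t) eq))
    ... | inj₂ (inj₁ refl) = double≢odd (e * s) 0 (trans (sym (t-split e r)) (+-cancelʳ-≡ (2 * k) (e * t) 1 (trans eq (one-n k))))
    ... | inj₂ (inj₂ refl) = not-between-multiples e p (q + 1) (trans (double-injective (e * s) (k + 1) (trans (sym (t-split e r)) (trans (+-cancelʳ-≡ (2 * k) (e * t) (2 * k + 2) (trans eq (two-n k))) (double-k+1 k)))) (trans (cong (_+ 1) k≡) (k≡-suc s p q))) (m≤n+m 1 q) q+1<s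

    -- e·t + 1 ∈ {0, n, 2n}: not 0; n gives e·s = k = s·p + q with
    -- 0 < q < s; and e·t + 1 < 2n
    no-small-step-up : ∀ e → r2 * e + 1 ≤ k → StepUp e → ⊥
    no-small-step-up e le (divides c eq) with quotient<3 c _ eq lt
      where
      lt3 : e * t + 1 < 2 * n
      lt3 = ≤-trans (s≤s (+-monoˡ-≤ 1 (≤-trans (m≤m+n (e * t) 4) (small-step-bound e le)))) (≤-reflexive (sym (two-n′ k)))
      lt : e * t + 1 < 3 * n
      lt = ≤-trans lt3 (*-monoˡ-≤ n (s≤s (s≤s (z≤n {1}))))
    ... | inj₁ refl = 1+n≢0 (trans (+-comm 1 (e * t)) eq)
    ... | inj₂ (inj₁ refl) = not-between-multiples e p q (trans (double-injective (e * s) k (trans (sym (t-split e r)) (trans (+-cancelʳ-≡ 1 (e * t) (2 * k) (trans eq (trans (one-n k) (+-comm 1 (2 * k))))) (double-k k)))) k≡) (n≢0⇒n>0 q≢0) q<s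
    ... | inj₂ (inj₂ refl) = <⇒≢ lt3 eq
      where
      lt3 : e * t + 1 < 2 * n
      lt3 = ≤-trans (s≤s (+-monoˡ-≤ 1 (≤-trans (m≤m+n (e * t) 4) (small-step-bound e le)))) (≤-reflexive (sym (two-n′ k)))

    -- Consecutive indices differ by a step e ≤ k which is the
    -- same throughout (it is determined by e·t ≡ ±1), so the 2r + 1 indices
    -- form an arithmetic progression inside (k, 2k]; its step is then too
    -- small to exist.
    module AvoidingWindow (1≤k : 1 ≤ k) (x : ℕ) (none : ∀ m → m ≤ r2 → progression k (x + m) ≡ false) where
      index : ℕ → ℕ
      index y = proj₁ (reaches-every-residue y)
      index-divides : ∀ y → n ∣ y + index y * t
      index-divides y = proj₂ (proj₂ (reaches-every-residue y))
      idx : ℕ → ℕ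
      idx m = index (x + m)
      idx≤2k : ∀ m → idx m ≤ k + k
      idx≤2k m = ≤-trans (s≤s⁻¹ (proj₁ (proj₂ (reaches-every-residue (x + m))))) (≤-reflexive (cong (k +_) (+-identityʳ k)))
      idx>k : ∀ m → m ≤ r2 → k < idx m
      idx>k m m≤ with idx m ≤? k
      ... | no ¬le = ≰⇒> ¬le
      ... | yes le with trans (sym (progression-complete k (x + m) (idx m) le (index-divides (x + m)))) (none m m≤)
      ... | ()

      small-multiple : ∀ d → n ∣ d → d < n → d ≡ 0
      small-multiple zero _ _ = refl
      small-multiple (suc d) dv lt = ⊥-elim (<⇒≱ lt (∣⇒≤ dv))

      step-unique≤ : ∀ Z e e' → e ≤ e' → e' ≤ k → n ∣ e * t + Z → n ∣ e' * t + Z → e ≡ e'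
      step-unique≤ Z e e' e≤ e'≤ d1 d2 = trans (sym (+-identityʳ e)) (trans (cong (e +_) (sym d0)) (m+[n∸m]≡n e≤))
        where
        d = e' ∸ e
        eqd : e' * t + Z ≡ e * t + Z + d * t
        eqd = trans (cong (λ z → z * t + Z) (sym (m+[n∸m]≡n e≤))) (rearrange e d t Z)
          where
          rearrange : ∀ e d t Z → (e + d) * t + Z ≡ e * t + Z + d * t
          rearrange = solve-∀
        d0 : d ≡ 0
        d0 = small-multiple d (coprime d (∣m+n∣m⇒∣n (subst (n ∣_) eqd d2) d1)) (≤-trans (s≤s (≤-trans (m∸n≤m e' e) e'≤)) (s≤s (m≤m+n k (k + 0))))

      step-unique : ∀ Z e e' → e ≤ k → e' ≤ k → n ∣ e * t + Z → n ∣ e' * t + Z → e ≡ e'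
      step-unique Z e e' e≤k e'≤k d1 d2 with ≤-total e e'
      ... | inj₁ le = step-unique≤ Z e e' le e'≤k d1 d2
      ... | inj₂ ge = sym (step-unique≤ Z e' e ge e≤k d2 d1)

      -- steps of both kinds would give n ∣ (e + e')·t with e + e' < n
      not-up-and-down : ∀ e e' → e ≤ k → e' ≤ k → StepDown e → StepUp e' → ⊥
      not-up-and-down e e' e≤ e'≤ d1 d2 with small-multiple (e + e') (coprime (e + e') (∣m+n∣m⇒∣n {n} (subst (n ∣_) (rearrange e e' t k) (∣m∣n⇒∣m+n d1 d2)) (n∣n {n}))) (s≤s (≤-trans (+-mono-≤ e≤ e'≤) (≤-reflexive (cong (k +_) (sym (+-identityʳ k))))))
        where
        rearrange : ∀ e e' t k → e * t + 2 * k + (e' * t + 1) ≡ suc (2 * k) + (e + e') * t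
        rearrange = solve-∀
      ... | ee with m+n≡0⇒n≡0 e ee
      ... | refl = n≢1 (∣1⇒≡1 d2)
        where
        n≢1 : n ≢ 1
        n≢1 e1 with trans (sym (cong (k +_) (+-identityʳ k))) (suc-injective e1)
        ... | kk = <⇒≱ 1≤k (≤-reflexive (m+n≡0⇒n≡0 k kk))

      IndexStep : ℕ → Set
      IndexStep m = Σ ℕ λ e → e ≤ k × ((StepDown e × idx m ≡ idx (suc m) + e) ⊎ (StepUp e × idx (suc m) ≡ idx m + e))

      step≤k : ∀ m → suc m ≤ r2 → ∀ {u w} e → u ≡ w + e → u ≡ idx m ⊎ u ≡ idx (suc m) → w ≡ idx m ⊎ w ≡ idx (suc m) → e ≤ k
      step≤k m sm≤ e ue wa wb = +-cancelʳ-≤ (suc k) e k (≤-trans (+-monoʳ-≤ e (wgt wb)) (≤-trans (≤-reflexive (trans (+-comm e _) (sym ue))) (≤-trans (ule wa) (+-monoʳ-≤ k (n≤1+n k)))))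
        where
        wgt : ∀ {w} → w ≡ idx m ⊎ w ≡ idx (suc m) → suc k ≤ w
        wgt (inj₁ refl) = idx>k m (≤-trans (n≤1+n m) sm≤)
        wgt (inj₂ refl) = idx>k (suc m) sm≤
        ule : ∀ {u} → u ≡ idx m ⊎ u ≡ idx (suc m) → u ≤ k + k
        ule (inj₁ refl) = idx≤2k m
        ule (inj₂ refl) = idx≤2k (suc m)

      -- consecutive indices differ by a step, of size ≤ k as both lie in (k, 2k]
      index-step : ∀ m → suc m ≤ r2 → IndexStep m
      index-step m sm≤ with idx (suc m) ≤? idx m
      ... | yes le = e , step≤k m sm≤ e eq (inj₁ refl) (inj₂ refl) , inj₁ (dn , eq)
        where
        b = idx (suc m)
        e = idx m ∸ b
        eq : idx m ≡ b + e
        eq = sym (m+[n∸m]≡n le)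
        rearrange : ∀ x m b e t k → x + suc m + b * t + (e * t + 2 * k) ≡ x + m + (b + e) * t + suc (2 * k)
        rearrange = solve-∀
        dn : StepDown e
        dn = ∣m+n∣m⇒∣n (subst (n ∣_) (sym (trans (rearrange x m b e t k) (cong (λ z → x + m + z * t + n) (sym eq)))) (∣m∣n⇒∣m+n (index-divides (x + m)) (n∣n {n}))) (index-divides (x + suc m))
      ... | no gt = e , step≤k m sm≤ e eq (inj₂ refl) (inj₁ refl) , inj₂ (up , eq)
        where
        am = idx m
        e = idx (suc m) ∸ am
        eq : idx (suc m) ≡ am + e
        eq = sym (m+[n∸m]≡n (<⇒≤ (≰⇒> gt)))
        rearrange : ∀ x m idx e t → x + m + idx * t + (e * t + 1) ≡ x + suc m + (idx + e) * t
        rearrange = solve-∀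
        up : StepUp e
        up = ∣m+n∣m⇒∣n (subst (n ∣_) (sym (trans (rearrange x m am e t) (cong (λ z → x + suc m + z * t) (sym eq)))) (index-divides (x + suc m))) (index-divides (x + m))

      e0≤r2 : 1 ≤ r2
      e0≤r2 = ≤-trans 1≤r (m≤m+n r (r + 0))

      -- all steps agree with the first one, so the indices are arithmetic
      idx-descending : ∀ e0 → e0 ≤ k → StepDown e0 → ∀ m → m ≤ r2 → idx m + m * e0 ≡ idx 0
      idx-descending e0 e0≤ d0 zero _ = +-identityʳ (idx 0)
      idx-descending e0 e0≤ d0 (suc m) sm≤ with index-step m sm≤
      ... | e , e≤ , inj₁ (de , eq) = trans (cong (idx (suc m) +_) (cong (_+ m * e0) (sym ee))) (trans (sym (+-assoc (idx (suc m)) e (m * e0))) (trans (cong (_+ m * e0) (sym eq)) (idx-descending e0 e0≤ d0 m (≤-trans (n≤1+n m) sm≤))))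
        where
        ee : e ≡ e0
        ee = step-unique (2 * k) e e0 e≤ e0≤ de d0
      ... | e , e≤ , inj₂ (ue , eq) = ⊥-elim (not-up-and-down e0 e e0≤ e≤ d0 ue)

      idx-ascending : ∀ e0 → e0 ≤ k → StepUp e0 → ∀ m → m ≤ r2 → idx m ≡ idx 0 + m * e0
      idx-ascending e0 e0≤ u0 zero _ = sym (+-identityʳ (idx 0))
      idx-ascending e0 e0≤ u0 (suc m) sm≤ with index-step m sm≤
      ... | e , e≤ , inj₁ (de , eq) = ⊥-elim (not-up-and-down e e0 e≤ e0≤ de u0)
      ... | e , e≤ , inj₂ (ue , eq) = trans eq (trans (cong (_+ e) (idx-ascending e0 e0≤ u0 m (≤-trans (n≤1+n m) sm≤))) (trans (+-assoc (idx 0) (m * e0) e) (cong (idx 0 +_) (trans (+-comm (m * e0) e) (cong (_+ m * e0) ee)))))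
        where
        ee : e ≡ e0
        ee = step-unique 1 e e0 e≤ e0≤ ue u0

      -- 2r steps of size e₀ fit inside (k, 2k], so 2r·e₀ < k
      step-too-small : ∀ u w e0 → u + r2 * e0 ≤ w → suc k ≤ u → w ≤ k + k → r2 * e0 + 1 ≤ k
      step-too-small u w e0 le u> w< = +-cancelʳ-≤ k _ k (≤-trans (≤-reflexive (rearrange (r2 * e0) k)) (≤-trans (+-monoˡ-≤ (r2 * e0) u>) (≤-trans le w<)))
        where
        rearrange : ∀ X k → X + 1 + k ≡ suc k + X
        rearrange = solve-∀

      impossible : ⊥
      impossible with index-step 0 e0≤r2
      ... | e0 , e0≤ , inj₁ (d0 , _) = no-small-step-down e0 (step-too-small (idx r2) (idx 0) e0 (≤-reflexive (idx-descending e0 e0≤ d0 r2 ≤-refl)) (idx>k r2 ≤-refl) (idx≤2k 0)) d0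
      ... | e0 , e0≤ , inj₂ (u0 , _) = no-small-step-up e0 (step-too-small (idx 0) (idx r2) e0 (≤-reflexive (sym (idx-ascending e0 e0≤ u0 r2 ≤-refl))) (idx>k 0 z≤n) (idx≤2k r2)) u0

    progression-windowCover : 1 ≤ k → ∀ x → Σ ℕ λ m → m ≤ r2 × progression k (x + m) ≡ true
    progression-windowCover 1≤k x with search (suc r2) (λ m → progression k (x + m) ≡ true) (λ m → progression k (x + m) Bool.≟ true)
    ... | inj₁ (m , m< , found) = m , s≤s⁻¹ m< , found
    ... | inj₂ none = ⊥-elim (AvoidingWindow.impossible 1≤k x (λ m m≤ → not-true (none m (s≤s m≤))))
      where
      not-true : ∀ {b} → ¬ (b ≡ true) → b ≡ false
      not-true {true} b≢ = ⊥-elim (b≢ refl)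
      not-true {false} _ = refl

module PredicateCodes (k r : ℕ) where
  open FiniteSums
  open CycleCodes k r
  open Counting k r using (card-tabulate)

  codeOf : (ℕ → Bool) → Subset n
  codeOf f = tabulate (λ i → f (toℕ i))

  InCode-tabulate : ∀ f y → f (y % n) ≡ true → InCode (codeOf f) y
  InCode-tabulate f y e = trans (lookup∘tabulate (λ i → f (toℕ i)) (vertex y)) (trans (cong f (toℕ-vertex y)) e)

  %-+ : ∀ y m → (y % n + m) % n ≡ (y + m) % n
  %-+ y m = un (≈-+ m (≈-mod y))

  pairCover-tabulate : ∀ f → (∀ y → y < n → f y ≡ true ⊎ f ((y + s) % n) ≡ true) → PairCover (codeOf f)
  pairCover-tabulate f hyp y with hyp (y % n) (m%n<n y n)
  ... | inj₁ e = inj₁ (InCode-tabulate f y e)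
  ... | inj₂ e = inj₂ (InCode-tabulate f (y + s) (trans (cong f (sym (%-+ y s))) e))

  windowCover-tabulate : ∀ f → (∀ y → y < n → Σ ℕ λ m → m ≤ r2 × f ((y + m) % n) ≡ true) → WindowCover (codeOf f)
  windowCover-tabulate f hyp y with hyp (y % n) (m%n<n y n)
  ... | m , m≤ , e = m , m≤ , InCode-tabulate f (y + m) (trans (cong f (sym (%-+ y m))) e)

  card-code : ∀ f → ∣ codeOf f ∣ ≡ ∑ n (λ x → bit (f x))
  card-code f = card-tabulate f

  module _ (f : ℕ → Bool) (periodic : ∀ x → f (x + n) ≡ f x) where

    f-mod : ∀ x → f (x % n) ≡ f x
    f-mod x = trans (sym (iterate (x % n) (x / n))) (cong f (sym (m≡m%n+[m/n]*n x n)))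
      where
      iterate : ∀ x q → f (x + q * n) ≡ f x
      iterate x zero = cong f (+-identityʳ x)
      iterate x (suc q) = trans (cong f (trans (cong (x +_) (+-comm n (q * n))) (sym (+-assoc x (q * n) n))))
                                (trans (periodic (x + q * n)) (iterate x q))

    pairCover-periodic : (∀ y → f y ≡ true ⊎ f (y + s) ≡ true) → PairCover (codeOf f)
    pairCover-periodic pair = pairCover-tabulate f (λ y _ → reduce (pair y))
      where
      reduce : ∀ {y} → f y ≡ true ⊎ f (y + s) ≡ true → f y ≡ true ⊎ f ((y + s) % n) ≡ true
      reduce (inj₁ e) = inj₁ e
      reduce {y} (inj₂ e) = inj₂ (trans (f-mod (y + s)) e)

    windowCover-periodic : (∀ y → Σ ℕ λ m → m ≤ r2 × f (y + m) ≡ true) → WindowCover (codeOf f)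
    windowCover-periodic window = windowCover-tabulate f (λ y _ → let (m , m≤ , e) = window y in m , m≤ , trans (f-mod (y + m)) e)

module AntiPeriodic (s : ℕ) {{_ : NonZero s}} where
  open FiniteSums

  π : ℕ
  π = s + s

  instance
    π-nonZero : NonZero π
    π-nonZero = >-nonZero (≤-trans (>-nonZero⁻¹ s) (m≤m+n s s))

  antiPeriodic : (ℕ → Bool) → ℕ → Bool
  antiPeriodic A ρ = if does (ρ <? s) then A ρ else not (A (ρ ∸ s))

  antiPeriodic-low : ∀ A ρ → ρ < s → antiPeriodic A ρ ≡ A ρ
  antiPeriodic-low A ρ lt rewrite dec-true (ρ <? s) lt = refl

  antiPeriodic-high : ∀ A i → antiPeriodic A (s + i) ≡ not (A i)
  antiPeriodic-high A i rewrite dec-false ((s + i) <? s) (λ lt → <⇒≱ lt (m≤m+n s i)) = cong (λ z → not (A z)) (m+n∸m≡n s i)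

  mod-π : ∀ ρ β → ρ < π → (ρ + β * π) % π ≡ ρ
  mod-π ρ β lt = trans ([m+kn]%n≡m%n ρ β π) (m<n⇒m%n≡m lt)

  div-mod : ∀ x → x ≡ x % π + (x / π) * π
  div-mod x = m≡m%n+[m/n]*n x π

  true-or-not : ∀ b → b ≡ true ⊎ not b ≡ true
  true-or-not true = inj₁ refl
  true-or-not false = inj₂ refl

  -- x and x + s lie in opposite halves of the period, one of them is hit
  antiPeriodic-pair : ∀ A x → antiPeriodic A (x % π) ≡ true ⊎ antiPeriodic A ((x + s) % π) ≡ true
  antiPeriodic-pair A x with x % π <? s
  ... | yes lt with true-or-not (A (x % π))
  ...   | inj₁ e = inj₁ (trans (antiPeriodic-low A _ lt) e)
  ...   | inj₂ e = inj₂ (trans (cong (antiPeriodic A) eqm) (trans (cong (antiPeriodic A) (+-comm (x % π) s)) (trans (antiPeriodic-high A (x % π)) e)))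
    where
    eqm : (x + s) % π ≡ x % π + s
    eqm = trans (cong (λ z → (z + s) % π) (div-mod x)) (trans (cong (_% π) (xy∙z≈xz∙y (x % π) ((x / π) * π) s)) (mod-π (x % π + s) (x / π) (+-monoˡ-< s lt)))
  antiPeriodic-pair A x | no ¬lt with true-or-not (A i)
    where i = x % π ∸ s
  ... | inj₁ e = inj₂ (trans (cong (antiPeriodic A) eqm) (trans (antiPeriodic-low A i i<s) e))
    where
    i = x % π ∸ s
    ρeq : x % π ≡ s + i
    ρeq = sym (m+[n∸m]≡n (≮⇒≥ ¬lt))
    i<s : i < s
    i<s = +-cancelˡ-< s i s (subst (_< π) ρeq (m%n<n x π))
    eqm : (x + s) % π ≡ i
    eqm = trans (cong (λ z → (z + s) % π) (div-mod x)) (trans (cong (_% π) (trans (cong (λ z → z + (x / π) * π + s) ρeq) (rearrange s i ((x / π) * π)))) (mod-π i (suc (x / π)) (≤-trans i<s (m≤m+n s s))))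
      where
      rearrange : ∀ s i b → s + i + b + s ≡ i + (s + s + b)
      rearrange = solve-∀
  ... | inj₂ e = inj₁ (trans (cong (antiPeriodic A) (sym (m+[n∸m]≡n (≮⇒≥ ¬lt)))) (trans (antiPeriodic-high A i) e))
    where
    i = x % π ∸ s

  ∑-antiPeriodic : ∀ A → ∑ π (λ ρ → bit (antiPeriodic A ρ)) ≡ s
  ∑-antiPeriodic A = trans (∑-split s s _) (trans (sym (trans (∑-+ s (λ ρ → bit (A ρ)) (λ ρ → bit (not (A ρ))))
    (cong₂ _+_ (∑-cong s (λ ρ lt → cong bit (sym (antiPeriodic-low A ρ lt)))) (∑-cong s (λ ρ _ → cong bit (sym (antiPeriodic-high A ρ))))))) (trans (∑-cong s (λ ρ _ → bit-complement (A ρ))) (trans (∑-const s 1) (*-identityʳ s))))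
    where
    bit-complement : ∀ b → bit b + bit (not b) ≡ 1
    bit-complement true = refl
    bit-complement false = refl

  ∑-antiPeriodic-blocks : ∀ p A → ∑ (p * π) (λ x → bit (antiPeriodic A (x % π))) ≡ p * s
  ∑-antiPeriodic-blocks p A = trans (∑-blocks p π _) (trans (∑-cong p (λ β _ → trans (∑-cong π (λ ρ lt → cong (λ z → bit (antiPeriodic A z)) (trans (cong (_% π) (+-comm (β * π) ρ)) (mod-π ρ β lt)))) (∑-antiPeriodic A))) (∑-const p s))

  block-of : ∀ p y → y < p * π → y % π < π × y / π < p
  block-of p y lt = m%n<n y π , m<n*o⇒m/o<n lt

  in-block : ∀ p ρ β → ρ < π → β < p → ρ + β * π < p * π
  in-block p ρ β ρ< β< = ≤-trans (+-monoˡ-≤ (β * π) ρ<) (*-monoˡ-≤ π β<)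

module ExceptionalCodes (k r : ℕ) where
  open FiniteSums
  open CycleCodes k r using (n; s; r2)
  open AntiPeriodic (2 * r + 1) {{>-nonZero (m≤n+m 1 (2 * r))}}

  mod-small : ∀ x → x < n → x % n ≡ x
  mod-small x = m<n⇒m%n≡m

  ∨-intro-right : ∀ a {b} → b ≡ true → a ∨ b ≡ true
  ∨-intro-right a e = trans (cong (a ∨_) e) (∨-zeroʳ a)

  wrap : ∀ y → y < n → s ≤ n → n ≤ y + s → (y + s) % n ≡ y + s ∸ n × y + s ∸ n < s
  wrap y y<n s≤n le = trans (sym (m≤n⇒[n∸m]%m≡n%m le)) (m<n⇒m%n≡m (≤-trans j<s s≤n)) , j<s
    where
    j<s : y + s ∸ n < s
    j<s = +-cancelʳ-< n (y + s ∸ n) s (≤-trans (≤-reflexive (cong suc (m∸n+n≡m le))) (≤-trans (+-monoˡ-< s y<n) (≤-reflexive (+-comm n s))))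

  module Region (p : ℕ) (1≤p : 1 ≤ p) (1≤r : 1 ≤ r) where

    M0 : ℕ
    M0 = p * π

    s≤π : s ≤ π
    s≤π = m≤m+n s s
    π≤M0 : π ≤ M0
    π≤M0 = ≤-trans (≤-reflexive (sym (*-identityˡ π))) (*-monoˡ-≤ π 1≤p)
    s≤M0 : s ≤ M0
    s≤M0 = ≤-trans s≤π π≤M0
    r2≥2 : 2 ≤ r2
    r2≥2 = *-monoʳ-≤ 2 1≤r
    3≤s : 3 ≤ s
    3≤s = +-monoˡ-≤ 1 r2≥2

  -- q = 0: n = p·2s + 1.  On [0, p·2s) take the anti-periodic pattern
  -- of period 2s whose first half is everything except position 1, add
  -- the vertex 1 back, and add the last vertex p·2s:  1 + p·s + 1 = k + 2.
  module CaseQ≡0 (p : ℕ) (1≤p : 1 ≤ p) (1≤r : 1 ≤ r) (k≡ : k ≡ s * p + 0) where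
    open Region p 1≤p 1≤r

    n≡ : n ≡ M0 + 1
    n≡ = trans (cong (λ z → suc (2 * z)) k≡) (rearrange r p)
      where
      rearrange : ∀ r p → suc (2 * ((2 * r + 1) * p + 0)) ≡ p * ((2 * r + 1) + (2 * r + 1)) + 1
      rearrange = solve-∀

    M0<n : M0 < n
    M0<n = ≤-trans (≤-reflexive (+-comm 1 M0)) (≤-reflexive (sym n≡))

    A0 : ℕ → Bool
    A0 ρ = not (does (ρ ≟ 1))

    f0 : ℕ → Bool
    f0 x = if does (x <? M0) then (does (x ≟ 1) ∨ antiPeriodic A0 (x % π)) else true

    f0-lo : ∀ x → x < M0 → f0 x ≡ (does (x ≟ 1) ∨ antiPeriodic A0 (x % π))
    f0-lo x lt rewrite dec-true (x <? M0) lt = refl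

    f0-hi : ∀ x → ¬ x < M0 → f0 x ≡ true
    f0-hi x nlt rewrite dec-false (x <? M0) nlt = refl

    -- PairCover: inside the pattern use its pair property; near the end the
    -- last vertex or the wrapped-around vertex 1 is hit
    pair-f0 : ∀ y → y < n → f0 y ≡ true ⊎ f0 ((y + s) % n) ≡ true
    pair-f0 y y<n with y + s <? M0
    ... | yes lt with antiPeriodic-pair A0 y
    ...   | inj₁ e = inj₁ (trans (f0-lo y (≤-trans (s≤s (m≤m+n y s)) lt)) (∨-intro-right _ e))
    ...   | inj₂ e = inj₂ (trans (cong f0 (mod-small (y + s) (<-trans lt M0<n))) (trans (f0-lo (y + s) lt) (∨-intro-right _ e)))
    pair-f0 y y<n | no nlt with y <? M0
    ... | no ylt = inj₁ (f0-hi y ylt)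
    ... | yes ylt with y + s <? n
    ...   | yes lt = inj₂ (trans (cong f0 (mod-small (y + s) lt)) (f0-hi (y + s) nlt))
    ...   | no nl with wrap y y<n (≤-trans s≤M0 (<⇒≤ M0<n)) (≮⇒≥ nl)
    ...     | eqj , j<s = inj₂ (trans (cong f0 eqj) (trans (f0-lo j (≤-trans j<s s≤M0)) (trans (cong (λ z → does (j ≟ 1) ∨ z) (trans (cong (antiPeriodic A0) (m<n⇒m%n≡m (≤-trans j<s s≤π))) (antiPeriodic-low A0 j j<s))) (∨-inverseʳ (does (j ≟ 1))))))
      where
      j = y + s ∸ n

    hit : ∀ y ρ' → y < M0 → y % π ≤ ρ' → ρ' < π → ρ' ∸ y % π ≤ r2 → antiPeriodic A0 ρ' ≡ true → Σ ℕ λ m → m ≤ r2 × f0 ((y + m) % n) ≡ true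
    hit y ρ' ylt le ρ'< m≤ wt = ρ' ∸ y % π , m≤ , trans (cong f0 (mod-small _ (<-trans ym< M0<n))) (trans (f0-lo _ ym<) (∨-intro-right _ (trans (cong (antiPeriodic A0) (trans (cong (_% π) yeq) (mod-π ρ' (y / π) ρ'<))) wt)))
      where
      yeq : y + (ρ' ∸ y % π) ≡ ρ' + (y / π) * π
      yeq = trans (cong (_+ (ρ' ∸ y % π)) (div-mod y)) (trans (xy∙z≈xz∙y (y % π) ((y / π) * π) (ρ' ∸ y % π)) (cong (_+ (y / π) * π) (m+[n∸m]≡n le)))
      ym< : y + (ρ' ∸ y % π) < M0
      ym< = subst (_< M0) (sym yeq) (in-block p ρ' (y / π) ρ'< (proj₂ (block-of p y ylt)))

    hit-next-block : ∀ y → y < M0 → π ∸ y % π ≤ r2 → Σ ℕ λ m → m ≤ r2 × f0 ((y + m) % n) ≡ true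
    hit-next-block y ylt m≤ = π ∸ y % π , m≤ , trans (cong f0 (mod-small _ (≤-trans (s≤s ym≤) M0<n))) fin
      where
      yeq : y + (π ∸ y % π) ≡ 0 + suc (y / π) * π
      yeq = trans (cong (_+ (π ∸ y % π)) (div-mod y)) (trans (xy∙z≈xz∙y (y % π) ((y / π) * π) (π ∸ y % π)) (cong (_+ (y / π) * π) (m+[n∸m]≡n (<⇒≤ (m%n<n y π)))))
      ym≤ : y + (π ∸ y % π) ≤ M0
      ym≤ = subst (_≤ M0) (sym yeq) (*-monoˡ-≤ π (proj₂ (block-of p y ylt)))
      fin : f0 (y + (π ∸ y % π)) ≡ true
      fin with y + (π ∸ y % π) <? M0
      ... | yes lt = trans (f0-lo _ lt) (∨-intro-right _ (trans (cong (antiPeriodic A0) (trans (cong (_% π) yeq) (mod-π 0 (suc (y / π)) (≤-trans (s≤s z≤n) (≤-trans 3≤s s≤π))))) (antiPeriodic-low A0 0 (≤-trans (s≤s z≤n) 3≤s))))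
      ... | no nlt = f0-hi _ nlt

    window-f0 : ∀ y → y < n → Σ ℕ λ m → m ≤ r2 × f0 ((y + m) % n) ≡ true
    window-f0 y y<n with y <? M0
    ... | no nlt = 0 , z≤n , trans (cong f0 (trans (cong (_% n) (+-identityʳ y)) (mod-small y y<n))) (f0-hi y nlt)
    ... | yes ylt with y % π ≤? 2
    ...   | yes le = hit y 2 ylt le (≤-trans 3≤s s≤π) (≤-trans (m∸n≤m 2 (y % π)) r2≥2) (antiPeriodic-low A0 2 3≤s)
    ...   | no nle with y % π <? s
    ...     | yes lt = hit y (y % π) ylt ≤-refl (m%n<n y π) (≤-trans (≤-reflexive (n∸n≡0 (y % π))) z≤n) (trans (antiPeriodic-low A0 (y % π) lt) (cong not (dec-false (y % π ≟ 1) (λ e → nle (≤-trans (≤-reflexive e) (n≤1+n 1))))))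
    ...     | no nlt with y % π ≤? s + 1
    ...       | yes le = hit y (s + 1) ylt le (+-monoʳ-< s (≤-trans (s≤s (s≤s z≤n)) 3≤s)) (≤-trans (∸-monoʳ-≤ (s + 1) (≮⇒≥ nlt)) (≤-trans (≤-reflexive (m+n∸m≡n s 1)) (≤-trans (s≤s z≤n) r2≥2))) (antiPeriodic-high A0 1)
    ...       | no nle2 = hit-next-block y ylt (≤-trans (∸-monoʳ-≤ π (≰⇒> nle2)) (≤-trans (≤-reflexive e1) (≤-trans (∸-monoʳ-≤ s (s≤s (z≤n {1}))) (≤-reflexive (m+n∸n≡m r2 1)))))
      where
      e1 : π ∸ suc (s + 1) ≡ s ∸ 2
      e1 = trans (cong (π ∸_) (sym (+-suc s 1))) ([m+n]∸[m+o]≡n∸o s s 2)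

    size-f0 : ∑ n (λ x → bit (f0 x)) ≡ k + 2
    size-f0 = trans (cong (λ z → ∑ z (λ x → bit (f0 x))) n≡) (trans (∑-split M0 1 _) (trans (cong₂ _+_ part1 part2) arith))
      where
      disj : ∀ x → does (x ≟ 1) ≡ true → antiPeriodic A0 (x % π) ≡ true → ⊥
      disj x e1 e2 with ≡ᵇ⇒≡ x 1 (subst T (sym e1) tt)
      ... | refl with trans (sym e2) (trans (cong (antiPeriodic A0) (m<n⇒m%n≡m (≤-trans (s≤s (s≤s z≤n)) (≤-trans 3≤s s≤π)))) (antiPeriodic-low A0 1 (≤-trans (s≤s (s≤s z≤n)) 3≤s)))
      ... | ()
      part1 : ∑ M0 (λ x → bit (f0 x)) ≡ 1 + p * s
      part1 = trans (∑-cong M0 (λ x lt → trans (cong bit (f0-lo x lt)) (bit-∨ _ _ (disj x))))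
        (trans (∑-+ M0 (λ x → bit (does (x ≟ 1))) (λ x → bit (antiPeriodic A0 (x % π))))
        (cong₂ _+_ (∑-single M0 1 (≤-trans (s≤s (s≤s z≤n)) (≤-trans 3≤s s≤M0)) (λ x _ ne → cong bit (dec-false (x ≟ 1) ne))) (∑-antiPeriodic-blocks p A0)))
      part2 : ∑ 1 (λ x → bit (f0 (M0 + x))) ≡ 1
      part2 = cong (_+ 0) (cong bit (f0-hi (M0 + 0) (λ lt → <-irrefl refl (subst (_< M0) (+-identityʳ M0) lt))))
      arith : 1 + p * s + 1 ≡ k + 2
      arith = trans (rearrange p s) (cong (_+ 2) (sym k≡))
        where
        rearrange : ∀ p s → 1 + p * s + 1 ≡ s * p + 0 + 2
        rearrange = solve-∀

  -- q = 2r: n = p·2s + (4r + 1).  On [0, p·2s) take the anti-periodic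
  -- pattern whose first half is the single position 2r - 1, and on the
  -- remaining 4r + 1 vertices take the last 2r + 2 of them:
  -- p·s + 2r + 2 = k + 2.
  module CaseQ≡2r (p : ℕ) (1≤p : 1 ≤ p) (1≤r : 1 ≤ r) (k≡ : k ≡ s * p + r2) where
    open Region p 1≤p 1≤r

    L2 : ℕ
    L2 = r2 + r2 + 1

    n≡ : n ≡ M0 + L2
    n≡ = trans (cong (λ z → suc (2 * z)) k≡) (rearrange r p)
      where
      rearrange : ∀ r p → suc (2 * ((2 * r + 1) * p + 2 * r)) ≡ p * ((2 * r + 1) + (2 * r + 1)) + (2 * r + 2 * r + 1)
      rearrange = solve-∀

    r2<s : r2 < s
    r2<s = ≤-reflexive (+-comm 1 r2)
    s≤L2 : s ≤ L2
    s≤L2 = +-monoˡ-≤ 1 (m≤n+m r2 r2)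
    M0<n : M0 < n
    M0<n = ≤-trans (m<m+n M0 (≤-trans (m≤n+m 1 r2) s≤L2)) (≤-reflexive (sym n≡))

    A2 : ℕ → Bool
    A2 ρ = does (suc ρ ≟ r2)

    f2 : ℕ → Bool
    f2 x = if does (x <? M0) then antiPeriodic A2 (x % π) else does (r2 ≤? suc (x ∸ M0))

    f2-lo : ∀ x → x < M0 → f2 x ≡ antiPeriodic A2 (x % π)
    f2-lo x lt rewrite dec-true (x <? M0) lt = refl

    f2-hi : ∀ x → ¬ x < M0 → f2 x ≡ does (r2 ≤? suc (x ∸ M0))
    f2-hi x nlt rewrite dec-false (x <? M0) nlt = refl

    tail-hit : ∀ j → j < L2 → r2 ≤ suc j → f2 ((M0 + j) % n) ≡ true
    tail-hit j j< le = trans (cong f2 (mod-small (M0 + j) (≤-trans (+-monoʳ-< M0 j<) (≤-reflexive (sym n≡))))) (trans (f2-hi (M0 + j) (λ lt → <⇒≱ lt (m≤m+n M0 j))) (trans (cong (λ z → does (r2 ≤? suc z)) (m+n∸m≡n M0 j)) (dec-true (r2 ≤? suc j) le)))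

    pair-f2 : ∀ y → y < n → f2 y ≡ true ⊎ f2 ((y + s) % n) ≡ true
    pair-f2 y y<n with y + s <? M0
    ... | yes lt with antiPeriodic-pair A2 y
    ...   | inj₁ e = inj₁ (trans (f2-lo y (≤-trans (s≤s (m≤m+n y s)) lt)) e)
    ...   | inj₂ e = inj₂ (trans (cong f2 (mod-small (y + s) (<-trans lt M0<n))) (trans (f2-lo (y + s) lt) e))
    pair-f2 y y<n | no nlt with y <? M0
    ... | yes ylt = res
      where
      i = y + s ∸ M0
      ys : y + s ≡ M0 + i
      ys = sym (m+[n∸m]≡n (≮⇒≥ nlt))
      i<s : i < s
      i<s = +-cancelˡ-< M0 i s (subst (_< M0 + s) ys (+-monoˡ-< s ylt))
      yρ : y % π ≡ s + i
      yρ = trans (sym ([m+n]%n≡m%n y π)) (trans (cong (_% π) (trans (sym (+-assoc y s s)) (trans (cong (_+ s) ys) (rearrange M0 i s)))) (mod-π (s + i) p (+-monoʳ-< s i<s)))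
        where
        rearrange : ∀ a b c → a + b + c ≡ c + b + a
        rearrange = solve-∀
      res : f2 y ≡ true ⊎ f2 ((y + s) % n) ≡ true
      res with suc i ≟ r2
      ... | yes e = inj₂ (trans (cong (λ z → f2 (z % n)) ys) (tail-hit i (≤-trans i<s s≤L2) (≤-reflexive (sym e))))
      ... | no ne = inj₁ (trans (f2-lo y ylt) (trans (cong (antiPeriodic A2) yρ) (trans (antiPeriodic-high A2 i) (cong not (dec-false (suc i ≟ r2) ne)))))
    ... | no nylt with r2 ≤? suc (y ∸ M0)
    ...   | yes le = inj₁ (trans (f2-hi y nylt) (dec-true (r2 ≤? suc (y ∸ M0)) le))
    ...   | no nle = inj₂ (trans (cong (λ z → f2 (z % n)) yeq) (tail-hit (j + s) bnd (≤-trans (<⇒≤ r2<s) (≤-trans (m≤n+m s j) (n≤1+n _)))))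
      where
      j = y ∸ M0
      yeq : y + s ≡ M0 + (j + s)
      yeq = trans (cong (_+ s) (sym (m+[n∸m]≡n (≮⇒≥ nylt)))) (+-assoc M0 j s)
      bnd : j + s < L2
      bnd = ≤-trans (+-monoˡ-< s (≤-trans (s≤s (n≤1+n j)) (≰⇒> nle))) (≤-reflexive (sym (+-assoc r2 r2 1)))

    hit : ∀ y ρ' → y < M0 → y % π ≤ ρ' → ρ' < π → ρ' ∸ y % π ≤ r2 → antiPeriodic A2 ρ' ≡ true → Σ ℕ λ m → m ≤ r2 × f2 ((y + m) % n) ≡ true
    hit y ρ' ylt le ρ'< m≤ wt = ρ' ∸ y % π , m≤ , trans (cong f2 (mod-small _ (<-trans ym< M0<n))) (trans (f2-lo _ ym<) (trans (cong (antiPeriodic A2) (trans (cong (_% π) yeq) (mod-π ρ' (y / π) ρ'<))) wt))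
      where
      yeq : y + (ρ' ∸ y % π) ≡ ρ' + (y / π) * π
      yeq = trans (cong (_+ (ρ' ∸ y % π)) (div-mod y)) (trans (xy∙z≈xz∙y (y % π) ((y / π) * π) (ρ' ∸ y % π)) (cong (_+ (y / π) * π) (m+[n∸m]≡n le)))
      ym< : y + (ρ' ∸ y % π) < M0
      ym< = subst (_< M0) (sym yeq) (in-block p ρ' (y / π) ρ'< (proj₂ (block-of p y ylt)))

    1≤r2 : 1 ≤ r2
    1≤r2 = ≤-trans (s≤s z≤n) r2≥2
    sr2 : suc (r2 ∸ 1) ≡ r2
    sr2 = m+[n∸m]≡n 1≤r2

    window-f2 : ∀ y → y < n → Σ ℕ λ m → m ≤ r2 × f2 ((y + m) % n) ≡ true
    window-f2 y y<n with y <? M0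
    ... | no nylt with r2 ≤? suc (y ∸ M0)
    ...   | yes le = 0 , z≤n , trans (cong f2 (trans (cong (_% n) (+-identityʳ y)) (mod-small y y<n))) (trans (f2-hi y nylt) (dec-true (r2 ≤? suc (y ∸ M0)) le))
    ...   | no nle = m , m∸n≤m r2 (suc j) , trans (cong (λ z → f2 (z % n)) yeq) (tail-hit (j + m) (≤-trans jm< (≤-trans (m≤m+n r2 r2) (m≤m+n (r2 + r2) 1))) (≤-reflexive (sym sjm)))
      where
      j = y ∸ M0
      m = r2 ∸ suc j
      sjm : suc (j + m) ≡ r2
      sjm = m+[n∸m]≡n (<⇒≤ (≰⇒> nle))
      jm< : j + m < r2
      jm< = ≤-reflexive sjm
      yeq : y + m ≡ M0 + (j + m)
      yeq = trans (cong (_+ m) (sym (m+[n∸m]≡n (≮⇒≥ nylt)))) (+-assoc M0 j m)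
    window-f2 y y<n | yes ylt with suc (y % π) ≤? r2
    ... | yes le = hit y (r2 ∸ 1) ylt (m+n≤o⇒m≤o∸n (y % π) (≤-trans (≤-reflexive (+-comm (y % π) 1)) le)) (≤-trans (s≤s (m∸n≤m r2 1)) (≤-trans r2<s s≤π)) (≤-trans (m∸n≤m _ (y % π)) (m∸n≤m r2 1)) (trans (antiPeriodic-low A2 (r2 ∸ 1) (≤-trans (s≤s (m∸n≤m r2 1)) r2<s)) (dec-true (suc (r2 ∸ 1) ≟ r2) sr2))
    ... | no nle with y % π <? s
    ...   | yes lt = hit y (s + 0) ylt (≤-trans (<⇒≤ lt) (≤-reflexive (sym (+-identityʳ s)))) (+-monoʳ-< s (≤-trans (s≤s z≤n) 3≤s)) (≤-trans (∸-monoʳ-≤ (s + 0) r2≤) (≤-trans (≤-reflexive (trans (cong (_∸ r2) (+-identityʳ s)) (m+n∸m≡n r2 1))) 1≤r2)) (trans (antiPeriodic-high A2 0) (cong not (dec-false (1 ≟ r2) (λ e → <⇒≢ r2≥2 e))))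
      where
      r2≤ : r2 ≤ y % π
      r2≤ = s≤s⁻¹ (≰⇒> nle)
    ...   | no nlt with suc (y % π ∸ s) ≟ r2
    ...     | no ne = hit y (y % π) ylt ≤-refl (m%n<n y π) (≤-trans (≤-reflexive (n∸n≡0 (y % π))) z≤n) (trans (cong (antiPeriodic A2) ρeq) (trans (antiPeriodic-high A2 (y % π ∸ s)) (cong not (dec-false (suc (y % π ∸ s) ≟ r2) ne))))
      where
      ρeq : y % π ≡ s + (y % π ∸ s)
      ρeq = sym (m+[n∸m]≡n (≮⇒≥ nlt))
    ...     | yes e = hit y (suc (y % π)) ylt (n≤1+n _) sρ< (≤-trans (≤-reflexive (trans (cong (_∸ y % π) (+-comm 1 (y % π))) (m+n∸m≡n (y % π) 1))) 1≤r2) (trans (cong (antiPeriodic A2) sρeq) (trans (antiPeriodic-high A2 (suc i)) (cong not (dec-false (suc (suc i) ≟ r2) (λ e' → <-irrefl (trans e (sym e')) (≤-refl))))))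
      where
      i = y % π ∸ s
      sρeq : suc (y % π) ≡ s + suc i
      sρeq = trans (cong suc (sym (m+[n∸m]≡n (≮⇒≥ nlt)))) (sym (+-suc s i))
      sρ< : suc (y % π) < π
      sρ< = subst (_< π) (sym (trans sρeq (cong (s +_) e))) (+-monoʳ-< s r2<s)

    size-f2 : ∑ n (λ x → bit (f2 x)) ≡ k + 2
    size-f2 = trans (cong (λ z → ∑ z (λ x → bit (f2 x))) n≡) (trans (∑-split M0 L2 _) (trans (cong₂ _+_ part1 part2) arith))
      where
      part1 : ∑ M0 (λ x → bit (f2 x)) ≡ p * s
      part1 = trans (∑-cong M0 (λ x lt → cong bit (f2-lo x lt))) (∑-antiPeriodic-blocks p A2)
      g : ℕ → ℕ
      g j = bit (does (r2 ≤? suc j))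
      L2≡ : L2 ≡ (r2 ∸ 1) + (r2 + 2)
      L2≡ = trans (cong (λ z → z + z + 1) (sym sr2)) (trans (rearrange (r2 ∸ 1)) (cong (λ z → (r2 ∸ 1) + (z + 2)) sr2))
        where
        rearrange : ∀ t → suc t + suc t + 1 ≡ t + (suc t + 2)
        rearrange = solve-∀
      part2 : ∑ L2 (λ j → bit (f2 (M0 + j))) ≡ r2 + 2
      part2 = trans (∑-cong L2 (λ j _ → cong bit (trans (f2-hi (M0 + j) (λ lt → <⇒≱ lt (m≤m+n M0 j))) (cong (λ z → does (r2 ≤? suc z)) (m+n∸m≡n M0 j)))))
        (trans (cong (λ z → ∑ z g) L2≡) (trans (∑-split (r2 ∸ 1) (r2 + 2) g)
        (cong₂ _+_ (∑-zero (r2 ∸ 1) (λ j j< → cong bit (dec-false (r2 ≤? suc j) (λ le → <⇒≱ (≤-trans (s≤s j<) (≤-reflexive sr2)) le))))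
          (trans (∑-cong (r2 + 2) (λ x _ → cong bit (dec-true (r2 ≤? suc (r2 ∸ 1 + x)) (≤-trans (≤-reflexive (sym sr2)) (s≤s (m≤m+n (r2 ∸ 1) x)))))) (trans (∑-const (r2 + 2) 1) (*-identityʳ (r2 + 2)))))))
      arith : p * s + (r2 + 2) ≡ k + 2
      arith = trans (rearrange p s r2) (cong (_+ 2) (sym k≡))
        where
        rearrange : ∀ p s r2 → p * s + (r2 + 2) ≡ s * p + r2 + 2
        rearrange = solve-∀

-- Case (a): g = gcd(s, n) ≥ 3.  Blowing up the progression code of the
-- cycle of length M = n/g by the factor g gives a code of size
-- g·(M + 1)/2, which matches the counting bound.
module BlowUp (k r : ℕ) where
  open FiniteSums
  open CycleCodes k r using (n; s; r2)

  -- Positions are x = c + B·g (column c < g of block B); vertex x is in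
  -- the code iff block B, shifted back by one in column 1, lies in the
  -- progression code P_K' of modulus M and shift s'.
  module Blocks (g : ℕ) {{_ : NonZero g}} (3≤g : 3 ≤ g) (K' s' : ℕ) (sg : s' * g ≡ s) where
    open ProgressionCodes K' s' using (M; progression; progression-periodic; module CoprimeModulus)

    -- column 1 is read one block earlier (2K' ≡ -1 modulo M)
    column-shift : ℕ → ℕ
    column-shift c = if does (c ≟ 1) then 2 * K' else 0

    blowup : ℕ → Bool
    blowup x = progression K' (x / g + column-shift (x % g))

    div-at : ∀ c B → c < g → (c + B * g) / g ≡ B
    div-at c B c<g = trans (+-distrib-/-∣ʳ c (divides B refl)) (cong₂ _+_ (m<n⇒m/n≡0 c<g) (m*n/n≡m B g))

    mod-at : ∀ c B → c < g → (c + B * g) % g ≡ c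
    mod-at c B c<g = trans ([m+kn]%n≡m%n c B g) (m<n⇒m%n≡m c<g)

    blowup-at : ∀ c B → c < g → blowup (c + B * g) ≡ progression K' (B + column-shift c)
    blowup-at c B c<g = cong₂ (λ u w → progression K' (u + column-shift w)) (div-at c B c<g) (mod-at c B c<g)

    periodic-once : ∀ b → progression K' (b + 1 * M) ≡ progression K' b
    periodic-once b = trans (cong (λ z → progression K' (b + z)) (+-identityʳ M)) (progression-periodic K' b)

    div-mod : ∀ x → x ≡ x % g + (x / g) * g
    div-mod x = m≡m%n+[m/n]*n x g

    module Construction (Mg : M * g ≡ n) (coprime' : ∀ i → M ∣ i * (s' + s') → M ∣ i) where
      open CoprimeModulus coprime' using (progression-pairCover; progression-size)

      s'≥1 : 1 ≤ s'
      s'≥1 = n≢0⇒n>0 (λ e → 1+n≢0 (trans (+-comm 1 r2) (trans (sym sg) (cong (_* g) e))))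
      blockspan : ℕ
      blockspan = (s' ∸ 1) * g
      blockspan+g : blockspan + g ≡ s
      blockspan+g = trans (+-comm blockspan g) (trans (cong (_* g) (m+[n∸m]≡n s'≥1)) sg)
      g≤s : g ≤ s
      g≤s = ≤-trans (m≤n+m g blockspan) (≤-reflexive blockspan+g)

      -- n = M·g is a period, since M is a period of P_K'
      blowup-periodic : ∀ x → blowup (x + n) ≡ blowup x
      blowup-periodic x = trans (cong blowup e1) (trans (blowup-at (x % g) (x / g + M) (m%n<n x g)) (trans (cong (progression K') (xy∙z≈xz∙y (x / g) M (column-shift (x % g)))) (progression-periodic K' (x / g + column-shift (x % g)))))
        where
        e1 : x + n ≡ x % g + (x / g + M) * g
        e1 = trans (cong₂ _+_ (div-mod x) (sym Mg)) (trans (+-assoc (x % g) _ _) (cong (x % g +_) (sym (*-distribʳ-+ g (x / g) M))))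

      -- y + s lies s' blocks further in the same column
      blowup-pair : ∀ y → blowup y ≡ true ⊎ blowup (y + s) ≡ true
      blowup-pair y with progression-pairCover (y / g + column-shift (y % g))
      ... | inj₁ e = inj₁ e
      ... | inj₂ e = inj₂ (trans (cong blowup e1) (trans (blowup-at (y % g) (y / g + s') (m%n<n y g)) (trans (cong (progression K') (xy∙z≈xz∙y (y / g) s' (column-shift (y % g)))) e)))
        where
        e1 : y + s ≡ y % g + (y / g + s') * g
        e1 = trans (cong₂ _+_ (div-mod y) (sym sg)) (trans (+-assoc (y % g) _ _) (cong (y % g +_) (sym (*-distribʳ-+ g (y / g) s'))))

      3≤s : 3 ≤ s
      3≤s = ≤-trans 3≤g g≤s
      ≤r2-of-<s : ∀ m → m + 1 ≤ s → m ≤ r2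
      ≤r2-of-<s m le = +-cancelʳ-≤ 1 m r2 le
      shift-back-one-block : ∀ b0 → b0 + 2 * K' + s' ≡ b0 + (s' ∸ 1) + 1 * M
      shift-back-one-block b0 = trans (cong (b0 + 2 * K' +_) (sym (m+[n∸m]≡n s'≥1))) (rearrange b0 K' (s' ∸ 1))
        where
        rearrange : ∀ b K u → b + 2 * K + (1 + u) ≡ b + u + 1 * suc (2 * K)
        rearrange = solve-∀

      Window : ℕ → Set
      Window x = Σ ℕ λ m → m ≤ r2 × blowup (x + m) ≡ true

      -- Column 0: the column B = x / g or the one s' - 1 further is hit,
      -- through column 1 of block B or column 0 of block B + s' - 1.
      window-column0 : ∀ x → x % g ≡ 0 → Window x
      window-column0 x c0 with progression-pairCover (x / g + 2 * K')
      ... | inj₁ e = 1 , ≤r2-of-<s 1 (≤-trans (s≤s (s≤s z≤n)) 3≤s) , trans (cong blowup ex) (trans (blowup-at 1 (x / g) (≤-trans (s≤s (s≤s z≤n)) 3≤g)) e)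
        where
        ex : x + 1 ≡ 1 + (x / g) * g
        ex = trans (cong (_+ 1) (trans (div-mod x) (cong (_+ (x / g) * g) c0))) (+-comm _ 1)
      ... | inj₂ e = blockspan , ≤r2-of-<s blockspan (≤-trans (+-monoʳ-≤ blockspan (≤-trans (s≤s z≤n) 3≤g)) (≤-reflexive blockspan+g)) , trans (cong blowup ex) (trans (blowup-at 0 (x / g + (s' ∸ 1)) (≤-trans (s≤s z≤n) 3≤g)) (trans (cong (progression K') (+-identityʳ _)) (trans (sym (periodic-once (x / g + (s' ∸ 1)))) (trans (cong (progression K') (sym (shift-back-one-block (x / g)))) e))))
        where
        ex : x + blockspan ≡ 0 + (x / g + (s' ∸ 1)) * g
        ex = trans (cong (_+ blockspan) (trans (div-mod x) (cong (_+ (x / g) * g) c0))) (sym (*-distribʳ-+ g (x / g) (s' ∸ 1)))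
      -- Column 1: this vertex itself or column 2 of block B + s' - 1.
      window-column1 : ∀ x → x % g ≡ 1 → Window x
      window-column1 x c1 with progression-pairCover (x / g + 2 * K')
      ... | inj₁ e = 0 , z≤n , trans (cong blowup (+-identityʳ x)) (trans (cong (λ c → progression K' (x / g + column-shift c)) c1) e)
      ... | inj₂ e = blockspan + 1 , ≤r2-of-<s (blockspan + 1) (≤-trans (≤-reflexive (+-assoc blockspan 1 1)) (≤-trans (+-monoʳ-≤ blockspan (≤-trans (s≤s (s≤s z≤n)) 3≤g)) (≤-reflexive blockspan+g))) , trans (cong blowup ex) (trans (blowup-at 2 (x / g + (s' ∸ 1)) 3≤g) (trans (cong (progression K') (+-identityʳ _)) (trans (sym (periodic-once (x / g + (s' ∸ 1)))) (trans (cong (progression K') (sym (shift-back-one-block (x / g)))) e))))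
        where
        ex : x + (blockspan + 1) ≡ 2 + (x / g + (s' ∸ 1)) * g
        ex = trans (cong (_+ (blockspan + 1)) (trans (div-mod x) (cong (_+ (x / g) * g) c1))) (trans (rearrange ((x / g) * g) blockspan) (cong (2 +_) (sym (*-distribʳ-+ g (x / g) (s' ∸ 1)))))
          where
          rearrange : ∀ a b → 1 + a + (b + 1) ≡ 2 + (a + b)
          rearrange = solve-∀
      -- Columns c ≥ 2: column 1 of the next block or column 0 of block B + s'.
      window-column≥2 : ∀ x → x % g ≢ 0 → x % g ≢ 1 → Window x
      window-column≥2 x c0 c1 with progression-pairCover (x / g)
      ... | inj₁ e = m , m≤ , trans (cong blowup ex) (trans (blowup-at 1 (x / g + 1) (≤-trans (s≤s (s≤s z≤n)) 3≤g)) (trans (cong (progression K') (rearrange (x / g) K')) (trans (progression-periodic K' (x / g)) e)))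
        where
        c = x % g
        2≤c : 2 ≤ c
        2≤c = ≤∧≢⇒< (≤∧≢⇒< z≤n (λ e' → c0 (sym e'))) (λ e' → c1 (sym e'))
        c<g : c < g
        c<g = m%n<n x g
        m = g + 1 ∸ c
        m≤ : m ≤ r2
        m≤ = ≤r2-of-<s m (≤-trans (≤-reflexive (+-comm m 1)) (≤-trans (s≤s (∸-monoʳ-≤ (g + 1) 2≤c)) (≤-trans (≤-reflexive (cong suc (trans (cong (_∸ 2) (+-comm g 1)) refl))) (≤-trans (≤-reflexive (m+[n∸m]≡n (≤-trans (s≤s z≤n) 3≤g))) g≤s))))
        ex : x + m ≡ 1 + (x / g + 1) * g
        ex = trans (cong (_+ m) (div-mod x)) (trans (xy∙z≈xz∙y c ((x / g) * g) m) (trans (cong (_+ (x / g) * g) (m+[n∸m]≡n (≤-trans (<⇒≤ c<g) (m≤m+n g 1)))) (trans (lem3 g (x / g)) refl)))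
          where
          lem3 : ∀ g b → g + 1 + b * g ≡ 1 + (b + 1) * g
          lem3 = solve-∀
        rearrange : ∀ b K → b + 1 + 2 * K ≡ b + suc (2 * K)
        rearrange = solve-∀
      ... | inj₂ e = s ∸ c , ≤r2-of-<s (s ∸ c) (≤-trans (≤-reflexive (+-comm (s ∸ c) 1)) (≤-trans (≤-reflexive (sym (+-∸-assoc 1 (≤-trans (<⇒≤ (m%n<n x g)) g≤s)))) (∸-monoʳ-≤ (1 + s) 1≤c))) , trans (cong blowup ex) (trans (blowup-at 0 (x / g + s') (≤-trans (s≤s z≤n) 3≤g)) (trans (cong (progression K') (+-identityʳ _)) e))
        where
        c = x % g
        1≤c : 1 ≤ c
        1≤c = n≢0⇒n>0 c0
        ex : x + (s ∸ c) ≡ 0 + (x / g + s') * g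
        ex = trans (cong (_+ (s ∸ c)) (div-mod x)) (trans (xy∙z≈xz∙y c ((x / g) * g) (s ∸ c)) (trans (cong (_+ (x / g) * g) (m+[n∸m]≡n (≤-trans (<⇒≤ (m%n<n x g)) g≤s))) (trans (cong (_+ (x / g) * g) (sym sg)) (trans (+-comm (s' * g) _) (sym (*-distribʳ-+ g (x / g) s'))))))

      blowup-window : ∀ x → Window x
      blowup-window x with x % g ≟ 0 | x % g ≟ 1
      ... | yes c0 | _ = window-column0 x c0
      ... | no c0 | yes c1 = window-column1 x c1
      ... | no c0 | no c1 = window-column≥2 x c0 c1

      -- Each block B contributes the indicators of B ∈ P_K' in the g - 1
      -- columns c ≠ 1 and of B + 2K' ∈ P_K' in column 1; summing over the M
      -- blocks, every column contributes |P_K'| = K' + 1.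
      blowup-size : ∑ n (λ x → bit (blowup x)) ≡ g * suc K'
      blowup-size = begin
        ∑ n (λ x → bit (blowup x))                          ≡⟨ cong (λ z → ∑ z (λ x → bit (blowup x))) (sym Mg) ⟩
        ∑ (M * g) (λ x → bit (blowup x))                    ≡⟨ ∑-blocks M g _ ⟩
        ∑ M (λ B → ∑ g (λ c → bit (blowup (B * g + c))))    ≡⟨ ∑-cong M (λ B _ → block B) ⟩
        ∑ M (λ B → X B + (Y B + (X B + g₃ * X B)))          ≡⟨ columns ⟩
        suc K' + (suc K' + (suc K' + g₃ * suc K'))          ≡⟨ collect K' g₃ ⟩
        (3 + g₃) * suc K'                                   ≡⟨ cong (_* suc K') (m+[n∸m]≡n 3≤g) ⟩
        g * suc K'                                          ∎
        where
        open ≡-Reasoning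
        g₃ = g ∸ 3
        X Y : ℕ → ℕ
        X B = bit (progression K' (B + 0))
        Y B = bit (progression K' (B + 2 * K'))
        block : ∀ B → ∑ g (λ c → bit (blowup (B * g + c))) ≡ X B + (Y B + (X B + g₃ * X B))
        block B = trans (∑-cong g (λ c c<g → cong bit (trans (cong blowup (+-comm (B * g) c)) (blowup-at c B c<g))))
          (trans (cong (λ z → ∑ z (λ c → bit (progression K' (B + column-shift c)))) (sym (m+[n∸m]≡n 3≤g)))
                 (cong (λ z → X B + (Y B + (X B + z))) (∑-const g₃ (X B))))
        ∑X : ∑ M X ≡ suc K'
        ∑X = trans (∑-cong M (λ B _ → cong (λ z → bit (progression K' z)) (+-identityʳ B))) (progression-size K' (s≤s (m≤m+n K' (K' + 0))))
        ∑Y : ∑ M Y ≡ suc K'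
        ∑Y = trans (∑-shift M (λ B → bit (progression K' B)) (λ x → cong bit (progression-periodic K' x)) (2 * K'))
                   (progression-size K' (s≤s (m≤m+n K' (K' + 0))))
        columns : ∑ M (λ B → X B + (Y B + (X B + g₃ * X B))) ≡ suc K' + (suc K' + (suc K' + g₃ * suc K'))
        columns = trans (∑-+ M X (λ B → Y B + (X B + g₃ * X B))) (cong₂ _+_ ∑X
                    (trans (∑-+ M Y (λ B → X B + g₃ * X B)) (cong₂ _+_ ∑Y
                      (trans (∑-+ M X (λ B → g₃ * X B)) (cong₂ _+_ ∑X (trans (∑-* M g₃ X) (cong (g₃ *_) ∑X)))))))
        collect : ∀ K g₃ → suc K + (suc K + (suc K + g₃ * suc K)) ≡ (3 + g₃) * suc K
        collect = solve-∀

module OddNumbers where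
  open Parity

  two∤odd : ∀ a → ¬ 2 ∣ suc (a + a)
  two∤odd a (divides q eq) = double≢odd q a (sym (trans eq (trans (*-comm q 2) (cong (q +_) (+-identityʳ q)))))

  odd-coprime-2 : ∀ M a → M ≡ suc (a + a) → Coprime M 2
  odd-coprime-2 M a M-odd {d} (d∣M , d∣2) with ∣⇒≤ d∣2
  ... | d≤2 with d
  ...   | zero = ⊥-elim (case (0∣⇒≡0 d∣2))
    where
    case : 2 ≢ 0
    case ()
  ...   | suc zero = refl
  ...   | suc (suc zero) = ⊥-elim (two∤odd a (subst (2 ∣_) M-odd d∣M))
  ...   | suc (suc (suc _)) = ⊥-elim (<⇒≱ (s≤s (s≤s (s≤s z≤n))) d≤2)

  coprime-double : ∀ M σ → Coprime M σ → Coprime M 2 → ∀ i → M ∣ i * (σ + σ) → M ∣ i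
  coprime-double M σ cσ c2 i d = coprime-divisor c2 (coprime-divisor cσ (subst (M ∣_) (rearrange i σ) d))
    where
    rearrange : ∀ i σ → i * (σ + σ) ≡ σ * (2 * i)
    rearrange = solve-∀

  ceilDiv-odd-multiple : ∀ G K → 1 ≤ G → ceilDiv (suc (2 * K) * G) (2 * G) ≡ suc K
  ceilDiv-odd-multiple (suc g₁) K _ =
    trans (cong (_/ suc b) (rearrange K g₁))
      (trans (+-distrib-/-∣ʳ g₁ (divides (suc K) refl)) (cong₂ _+_ (m<n⇒m/n≡0 g₁<) (m*n/n≡m (suc K) (suc b))))
    where
    b = g₁ + suc (g₁ + 0)
    rearrange : ∀ K g₁ → suc (2 * K) * suc g₁ + (g₁ + suc (g₁ + 0)) ≡ g₁ + suc K * suc (g₁ + suc (g₁ + 0))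
    rearrange = solve-∀
    g₁< : g₁ < suc b
    g₁< = s≤s (m≤m+n g₁ _)

module MainTheorem (r k p q : ℕ) (1≤r : 1 ≤ r) (1≤p : 1 ≤ p) (q≤2r : q ≤ 2 * r)
                   (k≡ : k ≡ (2 * r + 1) * p + q) where
  open FiniteSums
  open OddNumbers
  open CycleCodes k r
  open Counting k r using (pairCount-bound; odd-cofactor; n≡k+k; module SharpBound)
  open PredicateCodes k r

  -- k ≥ s, so the characterisation of codes applies
  k≥s : 2 * r + 1 ≤ k
  k≥s = ≤-trans (≤-reflexive (sym (*-identityʳ s))) (≤-trans (*-monoʳ-≤ s 1≤p) (≤-trans (m≤m+n _ q) (≤-reflexive (sym k≡))))

  1≤k : 1 ≤ k
  1≤k = ≤-trans (m≤n+m 1 r2) k≥s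

  2k+1≡n : 2 * k + 1 ≡ n
  2k+1≡n = +-comm (2 * k) 1

  -- the counting bound with g = 1: every r-identifying code has ≥ k + 1 elements
  at-least-k+1 : ∀ D → IsIdCode G r D → k + 1 ≤ ∣ D ∣
  at-least-k+1 D code = *-cancelˡ-≤ 2 (≤-trans (≤-reflexive (double-k+1 k))
    (pairCount-bound D (code⇒pairCover k≥s D code) 1 n (*-identityʳ n) (divides s (sym (*-identityʳ s)))))
    where
    double-k+1 : ∀ k → 2 * (k + 1) ≡ 1 * suc (suc (2 * k))
    double-k+1 = solve-∀

  covers⇒code′ : ∀ D → PairCover D → WindowCover D → IsIdCode G r D
  covers⇒code′ = covers⇒code k≥s

  module WhenCoprime (gcd≡1 : gcd (2 * r + 1) (2 * k + 1) ≡ 1) where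

    n-s-coprime : Coprime n s
    n-s-coprime = coprime-sym (subst (Coprime s) 2k+1≡n (gcd≡1⇒coprime gcd≡1))

    cancel-2s : ∀ i → n ∣ i * (s + s) → n ∣ i
    cancel-2s = coprime-double n s n-s-coprime (odd-coprime-2 n k n≡k+k)

    cancel-s : ∀ i → n ∣ i * s → n ∣ i
    cancel-s i d = coprime-divisor n-s-coprime (subst (n ∣_) (*-comm i s) d)

  case-c : gcd (2 * r + 1) (2 * k + 1) ≡ 1 → ¬ (q ≡ 0) → ¬ (q ≡ 2 * r) → MinIdCode G r (k + 1)
  case-c gcd≡1 q≢0 q≢2r = (codeOf P , covers⇒code′ (codeOf P) pair window , size) , at-least-k+1
    where
    open WhenCoprime gcd≡1
    open ProgressionCodes k (2 * r + 1) using (progression; progression-periodic; module CoprimeModulus)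
    open CoprimeModulus cancel-2s using (progression-pairCover; progression-size)
    P : ℕ → Bool
    P = progression k
    pair : PairCover (codeOf P)
    pair = pairCover-periodic P (progression-periodic k) progression-pairCover
    window : WindowCover (codeOf P)
    window = windowCover-periodic P (progression-periodic k)
               (WindowProperty.progression-windowCover k r cancel-2s p q k≡ q≤2r q≢0 q≢2r 1≤r 1≤k)
    size : ∣ codeOf P ∣ ≡ k + 1
    size = trans (card-code P) (trans (progression-size k (s≤s (m≤m+n k (k + 0)))) (+-comm 1 k))

  -- (b), lower bound: a code with ≤ k + 1 elements would contradict SharpBound
  at-least-k+2 : gcd (2 * r + 1) (2 * k + 1) ≡ 1 → (q ≡ 0 ⊎ q ≡ 2 * r) → ∀ D → IsIdCode G r D → k + 2 ≤ ∣ D ∣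
  at-least-k+2 gcd≡1 q-extreme D code with k + 2 ≤? ∣ D ∣
  ... | yes k+2≤ = k+2≤
  ... | no k+2≰ = ⊥-elim (contradiction q-extreme)
    where
    open WhenCoprime gcd≡1
    small : 2 * ∣ D ∣ ≤ suc n
    small = ≤-trans (*-monoʳ-≤ 2 (s≤s⁻¹ (≤-trans (≰⇒> k+2≰) (≤-reflexive (+-suc k 1))))) (≤-reflexive (double-k+1 k))
      where
      double-k+1 : ∀ k → 2 * (k + 1) ≡ suc (suc (2 * k))
      double-k+1 = solve-∀
    open SharpBound D (code⇒pairCover k≥s D code) (code⇒windowCover D code) cancel-s small
    contradiction : q ≡ 0 ⊎ q ≡ 2 * r → ⊥
    contradiction (inj₁ q≡0) = no-code-when-q≡0 p (trans k≡ (cong (s * p +_) q≡0)) 1≤p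
    contradiction (inj₂ q≡2r) = no-code-when-q≡2r p (trans k≡ (cong (s * p +_) q≡2r)) 1≤p

  case-b : gcd (2 * r + 1) (2 * k + 1) ≡ 1 → (q ≡ 0 ⊎ q ≡ 2 * r) → MinIdCode G r (k + 2)
  case-b gcd≡1 (inj₁ q≡0) =
    (codeOf f0 , covers⇒code′ (codeOf f0) (pairCover-tabulate f0 pair-f0) (windowCover-tabulate f0 window-f0) , trans (card-code f0) size-f0) ,
    at-least-k+2 gcd≡1 (inj₁ q≡0)
    where open ExceptionalCodes.CaseQ≡0 k r p 1≤p 1≤r (trans k≡ (cong (s * p +_) q≡0))
  case-b gcd≡1 (inj₂ q≡2r) =
    (codeOf f2 , covers⇒code′ (codeOf f2) (pairCover-tabulate f2 pair-f2) (windowCover-tabulate f2 window-f2) , trans (card-code f2) size-f2) ,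
    at-least-k+2 gcd≡1 (inj₂ q≡2r)
    where open ExceptionalCodes.CaseQ≡2r k r p 1≤p 1≤r (trans k≡ (cong (s * p +_) q≡2r))

  -- (a): g = gcd(s, n) ≠ 1; then g ≥ 3, n = M·g with M = 2K' + 1, s = s'·g
  -- with s' coprime to M, and the blow-up code has g·(K' + 1) elements,
  -- which equals both the counting bound and the formula of the theorem.
  module CaseA (gcd≢1 : ¬ (gcd (2 * r + 1) (2 * k + 1) ≡ 1)) where

    g : ℕ
    g = gcd s (2 * k + 1)

    g∣s : g ∣ s
    g∣s = gcd[m,n]∣m s (2 * k + 1)

    g∣n : g ∣ n
    g∣n = subst (g ∣_) 2k+1≡n (gcd[m,n]∣n s (2 * k + 1))

    g≢0 : g ≢ 0
    g≢0 e = 1+n≢0 (trans (+-comm 1 r2) (gcd[m,n]≡0⇒m≡0 e))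

    instance
      g-nonZero : NonZero g
      g-nonZero = ≢-nonZero g≢0

    -- g is odd (it divides s) and g ≠ 1, so g ≥ 3
    3≤g : 3 ≤ g
    3≤g = ≥3 g g≢0 gcd≢1 (λ g≡2 → two∤odd r (subst (2 ∣_) (s-odd r) (subst (_∣ s) g≡2 g∣s)))
      where
      ≥3 : ∀ x → x ≢ 0 → x ≢ 1 → x ≢ 2 → 3 ≤ x
      ≥3 0 x≢0 _ _ = ⊥-elim (x≢0 refl)
      ≥3 1 _ x≢1 _ = ⊥-elim (x≢1 refl)
      ≥3 2 _ _ x≢2 = ⊥-elim (x≢2 refl)
      ≥3 (suc (suc (suc _))) _ _ _ = s≤s (s≤s (s≤s z≤n))
      s-odd : ∀ r → 2 * r + 1 ≡ suc (r + r)
      s-odd = solve-∀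

    L : ℕ
    L = n / g

    Lg : L * g ≡ n
    Lg = m/n*n≡m g∣n

    K' : ℕ
    K' = proj₁ (odd-cofactor g L Lg)

    L≡M : L ≡ suc (2 * K')
    L≡M = trans (proj₂ (odd-cofactor g L Lg)) (cong (λ z → suc (K' + z)) (sym (+-identityʳ K')))

    Mg : suc (2 * K') * g ≡ n
    Mg = subst (λ z → z * g ≡ n) L≡M Lg

    s' : ℕ
    s' = s / g

    s'g : s' * g ≡ s
    s'g = m/n*n≡m g∣s

    -- dividing by the gcd leaves coprime cofactors
    cancel-2s' : ∀ i → suc (2 * K') ∣ i * (s' + s') → suc (2 * K') ∣ i
    cancel-2s' = coprime-double (suc (2 * K')) s' M-s'-coprime (odd-coprime-2 (suc (2 * K')) K' (cong (λ z → suc (K' + z)) (+-identityʳ K')))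
      where
      M-s'-coprime : Coprime (suc (2 * K')) s'
      M-s'-coprime = subst (λ z → Coprime z s') L≡M (coprime-sym (subst (λ z → Coprime s' (z / g)) 2k+1≡n (coprime-/gcd s (2 * k + 1))))

    open BlowUp.Blocks k r g 3≤g K' s' s'g using (blowup; module Construction)
    open Construction Mg cancel-2s' using (blowup-periodic; blowup-pair; blowup-window; blowup-size)

    formula : g * ceilDiv (2 * k + 1) (2 * g) ≡ g * suc K'
    formula = cong (g *_) (trans (cong (λ z → ceilDiv z (2 * g)) (trans 2k+1≡n (sym Mg))) (ceilDiv-odd-multiple g K' (n≢0⇒n>0 g≢0)))

    D : Subset n
    D = codeOf blowup

    D-code : IsIdCode G r D
    D-code = covers⇒code′ D (pairCover-periodic blowup blowup-periodic blowup-pair) (windowCover-periodic blowup blowup-periodic blowup-window)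

    D-size : ∣ D ∣ ≡ g * ceilDiv (2 * k + 1) (2 * g)
    D-size = trans (card-code blowup) (trans blowup-size (sym formula))

    -- the counting bound for this g:  2|D'| ≥ g·(L + 1) = 2·g·(K' + 1)
    lower-bound : ∀ D' → IsIdCode G r D' → g * ceilDiv (2 * k + 1) (2 * g) ≤ ∣ D' ∣
    lower-bound D' code = subst (_≤ ∣ D' ∣) (sym formula) (*-cancelˡ-≤ 2 (≤-trans (≤-reflexive double)
      (pairCount-bound D' (code⇒pairCover k≥s D' code) g L Lg g∣s)))
      where
      rearrange : ∀ g K → 2 * (g * suc K) ≡ g * suc (suc (K + K))
      rearrange = solve-∀
      double : 2 * (g * suc K') ≡ g * suc L
      double = trans (rearrange g K') (cong (λ z → g * suc z) (sym (proj₂ (odd-cofactor g L Lg))))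

  case-a : ¬ (gcd (2 * r + 1) (2 * k + 1) ≡ 1) →
    MinIdCode G r (gcd (2 * r + 1) (2 * k + 1) * ceilDiv (2 * k + 1) (2 * gcd (2 * r + 1) (2 * k + 1)))
  case-a gcd≢1 = (D , D-code , D-size) , lower-bound
    where open CaseA gcd≢1

theorem3 : (r k p q : ℕ) → 1 ≤ r → 1 ≤ p → q ≤ 2 * r →
    k ≡ (2 * r + 1) * p + q →
    (¬ (gcd (2 * r + 1) (2 * k + 1) ≡ 1) →
      MinIdCode (Cycle (suc (2 * k))) r
        (gcd (2 * r + 1) (2 * k + 1) * ceilDiv (2 * k + 1) (2 * gcd (2 * r + 1) (2 * k + 1))))
    × (gcd (2 * r + 1) (2 * k + 1) ≡ 1 → (q ≡ 0 ⊎ q ≡ 2 * r) →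
      MinIdCode (Cycle (suc (2 * k))) r (k + 2))
    × (gcd (2 * r + 1) (2 * k + 1) ≡ 1 → ¬ (q ≡ 0) → ¬ (q ≡ 2 * r) →
      MinIdCode (Cycle (suc (2 * k))) r (k + 1))
theorem3 r k p q 1≤r 1≤p q≤2r k≡ = case-a , case-b , case-c
  where open MainTheorem r k p q 1≤r 1≤p q≤2r k≡
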